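{- Let $n, k \geq 1$ and let $r \geq 2$ be even. Then every $r$-uniform convex geometric hypergraph on $\Omega_n$ that contains no $k$-zigzag has at most $\frac{(k-1)(r-1)}{r}\binom{n}{r-1}$ edges; that is, $\mathrm{ex}_{\circlearrowright}(n,\mathsf{P}_k^r) \leq \frac{(k-1)(r-1)}{r}\binom{n}{r-1}$.
   Context: $\Omega_n$ is a set of $n$ points in strictly convex position in the plane, equipped with its cyclic (clockwise) ordering $\prec$. An $r$-uniform convex geometric hypergraph (cgh) on $\Omega_n$ is a set $H$ of $r$-element subsets of $\Omega_n$ (its edges). A segment of $\Omega_n$ is a set of consecutive points in the cyclic order; for disjoint segments we write $I_0 \prec I_1 \prec \dots \prec I_{r-1}$ if they appear in this order going once around clockwise, and each segment is linearly ordered by $\prec$ (clockwise from its first point). For $k \geq 1$ and even $r \geq 2$, a $k$-zigzag in $H$ is a sequence of distinct points $v_0, v_1, \dots, v_{k+r-2}$ of $\Omega_n$ such that $\{v_i,\dots,v_{i+r-1}\} \in H$ for all $0 \leq i < k$ (a tight $k$-path), and there exist disjoint segments $I_0 \prec I_1 \prec \dots \prec I_{r-1}$ of $\Omega_n$ with $\{v_i : i \equiv j \pmod r\} \subseteq I_j$ for $0 \le j < r$, such that (i) if $j$ is even then $v_j \prec v_{j+r} \prec v_{j+2r} \prec \cdots$ within $I_j$, and (ii) if $j$ is odd then $v_j \succ v_{j+r} \succ v_{j+2r} \succ \cdots$ within $I_j$. $\mathrm{ex}_{\circlearrowright}(n,\mathsf P_k^r)$ is the maximum number of edges of an $r$-uniform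 cgh on $\Omega_n$ containing no $k$-zigzag. -}

module Defs where

open import Data.Nat using (ℕ; zero; suc; _+_; _*_; _∸_; _≤_; _<_; _≤?_)
open import Data.Nat.Divisibility using (_∣_)
open import Data.Fin using (Fin; toℕ)
open import Data.Fin.Subset using (Subset; _∈_; ∣_∣)
open import Data.List using (List; length)
open import Data.List.Relation.Unary.All using (All)
open import Data.List.Relation.Unary.Unique.Propositional using (Unique)
import Data.List.Membership.Propositional as L
open import Data.Product using (Σ; ∃; _×_; Σ-syntax; ∃-syntax)
open import Relation.Binary.PropositionalEquality using (_≡_; _≢_)
open import Relation.Nullary using (¬_; yes; no)
open import Function.Bundles using (_⇔_)

-- Ω_n is modelled as Fin n; the clockwise cyclic order is 0 → 1 → … → n-1 → 0.

record CGH (n r : ℕ) : Set where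
  field
    edges   : List (Subset n)
    unique  : Unique edges
    uniform : All (λ e → ∣ e ∣ ≡ r) edges
open CGH public

-- Position of x when the cyclic order is read clockwise starting at s
-- (i.e. (x - s) mod n).
rot : {n : ℕ} → Fin n → Fin n → ℕ
rot {n} s x with toℕ s ≤? toℕ x
... | yes _ = toℕ x ∸ toℕ s
... | no  _ = toℕ x + n ∸ toℕ s

-- The vertex sequence v_0,…,v_{L-1} (L = k + r - 1) is encoded by v : ℕ → Fin n,
-- only indices < L being relevant.

IsEdgeAt : {n r : ℕ} → CGH n r → (ℕ → Fin n) → ℕ → Set
IsEdgeAt {n} {r} H v i =
  Σ[ e ∈ Subset n ] (e L.∈ edges H ×
    (∀ (x : Fin n) → (x ∈ e) ⇔ (Σ[ j ∈ ℕ ] (j < r × v (i + j) ≡ x))))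

-- k-zigzag in H (r even is a hypothesis of the theorem, not of this definition)
record Zigzag (n r k : ℕ) (H : CGH n r) : Set where
  field
    v        : ℕ → Fin n
    distinct : ∀ i j → i < k + r ∸ 1 → j < k + r ∸ 1 → i ≢ j → v i ≢ v j
    tight    : ∀ i → i < k → IsEdgeAt H v i
    -- Segments I_0 ≺ I_1 ≺ … ≺ I_{r-1}: reading Ω_n clockwise from the point s,
    -- I_j = { x | lo j ≤ rot s x ≤ hi j } with these intervals disjoint and in order.
    s        : Fin n
    lo hi    : Fin r → ℕ
    lo≤hi    : ∀ j → lo j ≤ hi j
    ordered  : ∀ (j j' : Fin r) → toℕ j < toℕ j' → hi j < lo j'
    bounded  : ∀ j → hi j < n
    -- v_i ∈ I_j whenever i ≡ j (mod r), i.e. i = j + m r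
    inSeg    : ∀ (j : Fin r) (m : ℕ) → toℕ j + m * r < k + r ∸ 1 →
                 lo j ≤ rot s (v (toℕ j + m * r)) × rot s (v (toℕ j + m * r)) ≤ hi j
    monotone : ∀ (j : Fin r) (m : ℕ) → toℕ j + suc m * r < k + r ∸ 1 →
                 (2 ∣ toℕ j → rot s (v (toℕ j + m * r)) < rot s (v (toℕ j + suc m * r))) ×
                 (¬ (2 ∣ toℕ j) → rot s (v (toℕ j + suc m * r)) < rot s (v (toℕ j + m * r)))

module Submission where

-- Write k = K + 1, r = m + 1.  An oriented edge is an edge of H listed
-- clockwise from one of its points; there are r |H| of them.  A local zigzag
-- is a tight path of oriented edges in which each new vertex is placed
-- between two vertices of the previous edge, on alternating sides; such a
-- path with k edges is already a k-zigzag (LocalToGlobal), so every local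
-- zigzag has at most K edges.  For each oriented edge w and parity p, let
-- longest w p be the length of the longest local zigzag ending in w whose
-- last index has parity p.  Fixing the last m points g of an oriented edge,
-- the candidates x completing x ∷ g can be ordered so that each chain ending
-- in x ∷ g extends to g followed by the next candidate y; a telescoping sum
-- (Telescoping) over the candidates gives, for both parities,
-- Σ (1 + longest (x ∷ g)) ≤ cap + Σ longest (g ∷ x), with the two caps
-- summing to 2K.  Summing over all g and using that rotation permutes the
-- oriented edges, the chain lengths cancel and 2 · #oriented edges ≤
-- 2K · #clockwise m-tuples = 2K m C(n, m) (Counting).  Deciding which chains
-- exist is classical, but the conclusion is a decidable inequality, so we
-- may assume it under double negation (FiniteDoubleNegation).

open import Defs
open import Data.Nat using (ℕ; zero; suc; s≤s; _≤?_; _*_; _∸_; _≤_; _<_)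
open import Data.Nat.Divisibility using (_∣_)
open import Data.Nat.Combinatorics using (_C_)
open import Data.List using (length)
open import Relation.Nullary using (¬_; Dec)
open import Relation.Nullary.Decidable using (decidable-stable; ¬¬-excluded-middle)
open import Relation.Nullary.Negation using (¬¬-map; DoubleNegation)

module Sums where
  open import Data.Nat using (ℕ; zero; suc; _+_; _*_; _≤_; z≤n; s≤s)
  open import Data.Nat.Properties
  open import Data.Fin using (Fin; zero; suc) renaming (_≟_ to _≟F_)
  open import Data.Fin.Properties using () renaming (suc-injective to fin-suc-injective)
  open import Data.Vec using (Vec; []; _∷_; _∷ʳ_)
  open import Data.Vec.Properties using (≡-dec; ∷-injective)
  open import Data.List using (List; []; _∷_; length)
  open import Data.List.Membership.Propositional using (_∈_)
  open import Data.List.Relation.Unary.Any using (here; there)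
  open import Data.List.Relation.Unary.All using (All; []; _∷_)
  open import Data.List.Relation.Unary.Unique.Propositional using (Unique)
  open import Data.List.Relation.Unary.AllPairs using ([]; _∷_)
  open import Data.Empty using (⊥-elim)
  open import Data.Product using (_×_; _,_; proj₁; proj₂)
  open import Data.Sum using (_⊎_; inj₁; inj₂)
  open import Function using (_∘_)
  open import Relation.Binary.PropositionalEquality
  open import Relation.Nullary using (Dec; yes; no; ¬_)
  open import Algebra.Properties.Semiring.Sum +-*-semiring public
    using (sum; sum-cong-≗; ∑-distrib-+; ∑-comm; *-distribˡ-sum; sum-replicate-zero)

  𝟙 : ∀ {a} {A : Set a} → Dec A → ℕ
  𝟙 (yes _) = 1
  𝟙 (no _) = 0

  𝟙-yes : ∀ {a} {A : Set a} (d : Dec A) → A → 𝟙 d ≡ 1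
  𝟙-yes (yes _) _ = refl
  𝟙-yes (no ¬a) a = ⊥-elim (¬a a)

  𝟙-no : ∀ {a} {A : Set a} (d : Dec A) → ¬ A → 𝟙 d ≡ 0
  𝟙-no (yes a) ¬a = ⊥-elim (¬a a)
  𝟙-no (no _) _ = refl

  𝟙-cong : ∀ {a b} {A : Set a} {B : Set b} (d : Dec A) (e : Dec B) → (A → B) → (B → A) → 𝟙 d ≡ 𝟙 e
  𝟙-cong (yes _) (yes _) f g = refl
  𝟙-cong (yes a) (no ¬b) f g = ⊥-elim (¬b (f a))
  𝟙-cong (no ¬a) (yes b) f g = ⊥-elim (¬a (g b))
  𝟙-cong (no _) (no _) f g = refl

  sum-mono : ∀ {n} {f g : Fin n → ℕ} → (∀ i → f i ≤ g i) → sum f ≤ sum g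
  sum-mono {zero} le = z≤n
  sum-mono {suc n} le = +-mono-≤ (le zero) (sum-mono (le ∘ suc))

  sum-zero : ∀ {n} {f : Fin n → ℕ} → (∀ i → f i ≡ 0) → sum f ≡ 0
  sum-zero {n} f≡0 = trans (sum-cong-≗ f≡0) (sum-replicate-zero n)

  sum-point : ∀ {n} (j : Fin n) (F : Fin n → ℕ) → sum (λ i → 𝟙 (i ≟F j) * F i) ≡ F j
  sum-point {suc n} zero F =
    trans (cong₂ _+_ (+-identityʳ (F zero)) (sum-zero {n} (λ i → refl))) (+-identityʳ (F zero))
  sum-point {suc n} (suc j) F =
    trans (sum-cong-≗ (λ i → cong (_* F (suc i)) (𝟙-cong (suc i ≟F suc j) (i ≟F j) fin-suc-injective (cong suc))))
          (sum-point j (F ∘ suc))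

  Σ-list : ∀ {b} {B : Set b} → List B → (B → ℕ) → ℕ
  Σ-list [] f = 0
  Σ-list (x ∷ xs) f = f x + Σ-list xs f

  Σ-list-cong : ∀ {b} {B : Set b} (L : List B) {f g : B → ℕ} → (∀ x → f x ≡ g x) → Σ-list L f ≡ Σ-list L g
  Σ-list-cong [] e = refl
  Σ-list-cong (x ∷ L) e = cong₂ _+_ (e x) (Σ-list-cong L e)

  Σ-list-const : ∀ {b} {B : Set b} c (L : List B) → Σ-list L (λ _ → c) ≡ c * length L
  Σ-list-const c [] = sym (*-zeroʳ c)
  Σ-list-const c (x ∷ L) = trans (cong (c +_) (Σ-list-const c L)) (sym (*-suc c (length L)))

  Σ-list-mono : ∀ {b q} {B : Set b} {Q : B → Set q} (L : List B) {f g : B → ℕ} →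
                All Q L → (∀ x → Q x → f x ≤ g x) → Σ-list L f ≤ Σ-list L g
  Σ-list-mono [] [] le = z≤n
  Σ-list-mono (x ∷ L) (q ∷ qs) le = +-mono-≤ (le x q) (Σ-list-mono L qs le)

  Σ-list-unique : ∀ {b} {B : Set b} (_≟_ : (x y : B) → Dec (x ≡ y)) (x : B) (L : List B) → Unique L →
                  Σ-list L (λ y → 𝟙 (x ≟ y)) ≤ 1 × (Σ-list L (λ y → 𝟙 (x ≟ y)) ≡ 0 ⊎ x ∈ L)
  Σ-list-unique _≟_ x [] [] = z≤n , inj₁ refl
  Σ-list-unique _≟_ x (y ∷ L) (x∉L ∷ uL) with x ≟ y
  ... | yes refl = ≤-reflexive (cong suc (absent L x∉L)) , inj₂ (here refl)
    where
    absent : ∀ L → All (x ≢_) L → Σ-list L (λ y → 𝟙 (x ≟ y)) ≡ 0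
    absent [] [] = refl
    absent (z ∷ L) (x≢z ∷ rest) rewrite 𝟙-no (x ≟ z) x≢z = absent L rest
  ... | no _ with Σ-list-unique _≟_ x L uL
  ...   | le , inj₁ none = le , inj₁ none
  ...   | le , inj₂ x∈L = le , inj₂ (there x∈L)

  Σ-list-member : ∀ {b} {B : Set b} (_≟_ : (x y : B) → Dec (x ≡ y)) (x : B) (L : List B) →
                  x ∈ L → 1 ≤ Σ-list L (λ y → 𝟙 (x ≟ y))
  Σ-list-member _≟_ x (y ∷ L) (here refl) rewrite 𝟙-yes (x ≟ x) refl = s≤s z≤n
  Σ-list-member _≟_ x (y ∷ L) (there x∈L) = ≤-trans (Σ-list-member _≟_ x L x∈L) (m≤n+m _ _)

  module Tuples {n : ℕ} where

    Σ-tuples : (m : ℕ) → (Vec (Fin n) m → ℕ) → ℕ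
    Σ-tuples zero F = F []
    Σ-tuples (suc m) F = Σ-tuples m (λ g → sum (λ x → F (x ∷ g)))

    Σ-tuples-cong : ∀ m {F G : Vec (Fin n) m → ℕ} → (∀ w → F w ≡ G w) → Σ-tuples m F ≡ Σ-tuples m G
    Σ-tuples-cong zero e = e []
    Σ-tuples-cong (suc m) e = Σ-tuples-cong m (λ g → sum-cong-≗ (λ x → e (x ∷ g)))

    Σ-tuples-mono : ∀ m {F G : Vec (Fin n) m → ℕ} → (∀ w → F w ≤ G w) → Σ-tuples m F ≤ Σ-tuples m G
    Σ-tuples-mono zero le = le []
    Σ-tuples-mono (suc m) le = Σ-tuples-mono m (λ g → sum-mono (λ x → le (x ∷ g)))

    Σ-tuples-+ : ∀ m (F G : Vec (Fin n) m → ℕ) → Σ-tuples m (λ w → F w + G w) ≡ Σ-tuples m F + Σ-tuples m G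
    Σ-tuples-+ zero F G = refl
    Σ-tuples-+ (suc m) F G = trans (Σ-tuples-cong m (λ g → ∑-distrib-+ (λ x → F (x ∷ g)) (λ x → G (x ∷ g)))) (Σ-tuples-+ m _ _)

    Σ-tuples-* : ∀ m c (F : Vec (Fin n) m → ℕ) → Σ-tuples m (λ w → c * F w) ≡ c * Σ-tuples m F
    Σ-tuples-* zero c F = refl
    Σ-tuples-* (suc m) c F = trans (Σ-tuples-cong m (λ g → sym (*-distribˡ-sum c (λ x → F (x ∷ g))))) (Σ-tuples-* m c _)

    Σ-tuples-zero : ∀ m {F : Vec (Fin n) m → ℕ} → (∀ w → F w ≡ 0) → Σ-tuples m F ≡ 0
    Σ-tuples-zero zero e = e []
    Σ-tuples-zero (suc m) e = Σ-tuples-zero m (λ g → sum-zero (λ x → e (x ∷ g)))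

    Σ-tuples-sum : ∀ m k (F : Vec (Fin n) m → Fin k → ℕ) →
                   Σ-tuples m (λ w → sum (F w)) ≡ sum (λ j → Σ-tuples m (λ w → F w j))
    Σ-tuples-sum zero k F = refl
    Σ-tuples-sum (suc m) k F =
      trans (Σ-tuples-cong m (λ g → ∑-comm (λ x → F (x ∷ g)))) (Σ-tuples-sum m k _)

    Σ-tuples-Σ-list : ∀ m {b} {B : Set b} (L : List B) (F : Vec (Fin n) m → B → ℕ) →
                      Σ-tuples m (λ w → Σ-list L (F w)) ≡ Σ-list L (λ u → Σ-tuples m (λ w → F w u))
    Σ-tuples-Σ-list m [] F = Σ-tuples-zero m (λ _ → refl)
    Σ-tuples-Σ-list m (x ∷ L) F = trans (Σ-tuples-+ m _ _) (cong (Σ-tuples m (λ w → F w x) +_) (Σ-tuples-Σ-list m L F))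

    rotate : ∀ {m} → Vec (Fin n) (suc m) → Vec (Fin n) (suc m)
    rotate (x ∷ g) = g ∷ʳ x

    Σ-tuples-rotate : ∀ m (G : Vec (Fin n) (suc m) → ℕ) → Σ-tuples (suc m) (G ∘ rotate) ≡ Σ-tuples (suc m) G
    Σ-tuples-rotate zero G = refl
    Σ-tuples-rotate (suc m) G = begin
      Σ-tuples m (λ g → sum (λ y → sum (λ x → G (y ∷ (g ∷ʳ x)))))
        ≡⟨ Σ-tuples-sum m n (λ g y → sum (λ x → G (y ∷ (g ∷ʳ x)))) ⟩
      sum (λ y → Σ-tuples m (λ g → sum (λ x → G (y ∷ (g ∷ʳ x)))))
        ≡⟨ sum-cong-≗ (λ y → Σ-tuples-rotate m (λ u → G (y ∷ u))) ⟩
      sum (λ y → Σ-tuples m (λ g → sum (λ x → G (y ∷ x ∷ g))))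
        ≡⟨ Σ-tuples-sum m n (λ g y → sum (λ x → G (y ∷ x ∷ g))) ⟨
      Σ-tuples m (λ g → sum (λ y → sum (λ x → G (y ∷ x ∷ g))))
        ≡⟨ Σ-tuples-cong m (λ g → ∑-comm (λ y x → G (y ∷ x ∷ g))) ⟩
      Σ-tuples m (λ g → sum (λ x → sum (λ y → G (y ∷ x ∷ g)))) ∎
      where open ≡-Reasoning

    _≟T_ : ∀ {m} → (u w : Vec (Fin n) m) → Dec (u ≡ w)
    _≟T_ = ≡-dec _≟F_

    Σ-tuples-point : ∀ m (u : Vec (Fin n) m) → Σ-tuples m (λ w → 𝟙 (w ≟T u)) ≡ 1
    Σ-tuples-point zero [] = refl
    Σ-tuples-point (suc m) (y ∷ u) = trans (Σ-tuples-cong m head-sum) (Σ-tuples-point m u)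
      where
      head-sum : ∀ g → sum (λ x → 𝟙 ((x ∷ g) ≟T (y ∷ u))) ≡ 𝟙 (g ≟T u)
      head-sum g = by-cases (g ≟T u)
        where
        by-cases : (d : Dec (g ≡ u)) → sum (λ x → 𝟙 ((x ∷ g) ≟T (y ∷ u))) ≡ 𝟙 d
        by-cases (yes refl) =
          trans (sum-cong-≗ (λ x → trans (𝟙-cong ((x ∷ g) ≟T (y ∷ g)) (x ≟F y) (proj₁ ∘ ∷-injective) (cong (_∷ g)))
                                         (sym (*-identityʳ _))))
                (sum-point y (λ _ → 1))
        by-cases (no g≢u) = sum-zero (λ x → 𝟙-no ((x ∷ g) ≟T (y ∷ u)) (g≢u ∘ proj₂ ∘ ∷-injective))

    count≤length : ∀ m {q} {Q : Vec (Fin n) m → Set q} (Q? : ∀ w → Dec (Q w)) (L : List (Vec (Fin n) m)) →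
                   (∀ w → Q w → w ∈ L) → Σ-tuples m (λ w → 𝟙 (Q? w)) ≤ length L
    count≤length m Q? L covers = begin
      Σ-tuples m (λ w → 𝟙 (Q? w))                    ≤⟨ Σ-tuples-mono m pointwise ⟩
      Σ-tuples m (λ w → Σ-list L (λ u → 𝟙 (w ≟T u))) ≡⟨ Σ-tuples-Σ-list m L _ ⟩
      Σ-list L (λ u → Σ-tuples m (λ w → 𝟙 (w ≟T u))) ≡⟨ Σ-list-cong L (Σ-tuples-point m) ⟩
      Σ-list L (λ _ → 1)                             ≡⟨ Σ-list-const 1 L ⟩
      1 * length L                                   ≡⟨ *-identityˡ (length L) ⟩
      length L                                       ∎
      where
      open ≤-Reasoning
      pointwise : ∀ w → 𝟙 (Q? w) ≤ Σ-list L (λ u → 𝟙 (w ≟T u))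
      pointwise w with Q? w
      ... | yes q = Σ-list-member _≟T_ w L (covers w q)
      ... | no _ = z≤n

    length≤count : ∀ m {q} {Q : Vec (Fin n) m → Set q} (Q? : ∀ w → Dec (Q w)) (L : List (Vec (Fin n) m)) →
                   Unique L → (∀ w → w ∈ L → Q w) → length L ≤ Σ-tuples m (λ w → 𝟙 (Q? w))
    length≤count m Q? L unique inQ = begin
      length L                                       ≡⟨ *-identityˡ (length L) ⟨
      1 * length L                                   ≡⟨ Σ-list-const 1 L ⟨
      Σ-list L (λ _ → 1)                             ≡⟨ Σ-list-cong L (Σ-tuples-point m) ⟨
      Σ-list L (λ u → Σ-tuples m (λ w → 𝟙 (w ≟T u))) ≡⟨ Σ-tuples-Σ-list m L _ ⟨
      Σ-tuples m (λ w → Σ-list L (λ u → 𝟙 (w ≟T u))) ≤⟨ Σ-tuples-mono m pointwise ⟩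
      Σ-tuples m (λ w → 𝟙 (Q? w))                    ∎
      where
      open ≤-Reasoning
      pointwise : ∀ w → Σ-list L (λ u → 𝟙 (w ≟T u)) ≤ 𝟙 (Q? w)
      pointwise w with Σ-list-unique _≟T_ w L unique
      ... | _ , inj₁ none = ≤-trans (≤-reflexive none) z≤n
      ... | le , inj₂ w∈L rewrite 𝟙-yes (Q? w) (inQ w w∈L) = le

module ClockwiseDistance where
  open import Data.Nat using (ℕ; zero; suc; _+_; _∸_; _≤_; _<_; _≤?_; _<?_; z≤n; s≤s)
  open import Data.Nat.Properties
  open import Data.Fin using (Fin; toℕ; fromℕ<)
  open import Data.Fin.Properties using (toℕ<n; toℕ-injective; toℕ-fromℕ<)
  open import Data.Product using (_×_; _,_; proj₁; proj₂)
  open import Data.Sum using (_⊎_; inj₁; inj₂)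
  open import Data.Empty using (⊥-elim)
  open import Relation.Binary.PropositionalEquality
  open import Relation.Nullary using (yes; no)
  open import Defs using (rot)
  open import Algebra.Properties.CommutativeSemigroup +-commutativeSemigroup using (xy∙z≈y∙xz; xy∙z≈xz∙y)

  -- `rot a b` is the clockwise distance from a to b on Ω_n = Fin n.  All its
  -- properties follow from the characterisation `rot-offset` below.
  module _ {n : ℕ} where

    Offset : ℕ → ℕ → ℕ → Set
    Offset d a b = d + a ≡ b ⊎ d + a ≡ b + n

    rot-offset : (a b : Fin n) → rot a b < n × Offset (rot a b) (toℕ a) (toℕ b)
    rot-offset a b with toℕ a ≤? toℕ b
    ... | yes a≤b = ≤-<-trans (m∸n≤m (toℕ b) (toℕ a)) (toℕ<n b) , inj₁ (m∸n+n≡m a≤b)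
    ... | no a≰b = below , inj₂ wraps
      where
      wraps : toℕ b + n ∸ toℕ a + toℕ a ≡ toℕ b + n
      wraps = m∸n+n≡m (≤-trans (<⇒≤ (toℕ<n a)) (m≤n+m n (toℕ b)))
      below : toℕ b + n ∸ toℕ a < n
      below = +-cancelʳ-< (toℕ a) _ _ (subst (_< n + toℕ a) (sym wraps)
                (subst (toℕ b + n <_) (+-comm (toℕ a) n) (+-monoˡ-< n (≰⇒> a≰b))))

    rot<n : (a b : Fin n) → rot a b < n
    rot<n a b = proj₁ (rot-offset a b)

    offset-unique : ∀ {d d' a b} → d < n → d' < n → Offset d a b → Offset d' a b → d ≡ d'
    offset-unique {d} {d'} {a} _ _ (inj₁ e) (inj₁ e') = +-cancelʳ-≡ a d d' (trans e (sym e'))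
    offset-unique {d} {d'} {a} _ _ (inj₂ e) (inj₂ e') = +-cancelʳ-≡ a d d' (trans e (sym e'))
    offset-unique {d} {d'} {a} {b} _ d'<n (inj₁ e) (inj₂ e') = ⊥-elim (<⇒≱ d'<n (+-cancelʳ-≤ a n d' le))
      where
      le : n + a ≤ d' + a
      le = ≤-trans (+-monoʳ-≤ n (m≤n+m a d)) (≤-reflexive (trans (cong (n +_) e) (trans (+-comm n b) (sym e'))))
    offset-unique {d} {d'} {a} {b} d<n _ (inj₂ e) (inj₁ e') = ⊥-elim (<⇒≱ d<n (+-cancelʳ-≤ a n d le))
      where
      le : n + a ≤ d + a
      le = ≤-trans (+-monoʳ-≤ n (m≤n+m a d')) (≤-reflexive (trans (cong (n +_) e') (trans (+-comm n b) (sym e))))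

    rot-unique : (a b : Fin n) (d : ℕ) → d < n → Offset d (toℕ a) (toℕ b) → rot a b ≡ d
    rot-unique a b d d<n off = offset-unique (rot<n a b) d<n (proj₂ (rot-offset a b)) off

    rot-self : (a : Fin n) → rot a a ≡ 0
    rot-self a = rot-unique a a 0 (≤-<-trans z≤n (toℕ<n a)) (inj₁ refl)

    rot-zero : (a b : Fin n) → rot a b ≡ 0 → a ≡ b
    rot-zero a b e with proj₂ (rot-offset a b)
    ... | inj₁ off = toℕ-injective (trans (sym (cong (_+ toℕ a) e)) off)
    ... | inj₂ off = ⊥-elim (<⇒≱ (toℕ<n a) (subst (n ≤_) (trans (sym off) (cong (_+ toℕ a) e)) (m≤n+m n (toℕ b))))

    rot-pos : (a b : Fin n) → a ≢ b → 0 < rot a b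
    rot-pos a b a≢b with rot a b in eq
    ... | zero = ⊥-elim (a≢b (rot-zero a b eq))
    ... | suc _ = s≤s z≤n

    rot-inj : (a b c : Fin n) → rot a b ≡ rot a c → b ≡ c
    rot-inj a b c e = toℕ-injective (same-target {rot a b} (proj₂ (rot-offset a b))
                        (subst (λ d → Offset d (toℕ a) (toℕ c)) (sym e) (proj₂ (rot-offset a c))) (toℕ<n b) (toℕ<n c))
      where
      same-target : ∀ {d a b c : ℕ} → Offset d a b → Offset d a c → b < n → c < n → b ≡ c
      same-target (inj₁ x) (inj₁ y) _ _ = trans (sym x) y
      same-target (inj₂ x) (inj₂ y) _ _ = +-cancelʳ-≡ n _ _ (trans (sym x) y)
      same-target {c = c} (inj₁ x) (inj₂ y) b<n _ = ⊥-elim (<⇒≱ b<n (subst (n ≤_) (trans (sym y) x) (m≤n+m n c)))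
      same-target {b = b} (inj₂ x) (inj₁ y) _ c<n = ⊥-elim (<⇒≱ c<n (subst (n ≤_) (trans (sym x) y) (m≤n+m n b)))

    offset-compose : ∀ d₁ d₂ s a b → Offset d₁ s a → Offset d₂ a b →
                     (d₁ + d₂) + s ≡ b ⊎ (d₁ + d₂) + s ≡ b + n ⊎ (d₁ + d₂) + s ≡ b + n + n
    offset-compose d₁ d₂ s a b (inj₁ x) (inj₁ y) = inj₁ (trans (xy∙z≈y∙xz d₁ d₂ s) (trans (cong (d₂ +_) x) y))
    offset-compose d₁ d₂ s a b (inj₁ x) (inj₂ y) = inj₂ (inj₁ (trans (xy∙z≈y∙xz d₁ d₂ s) (trans (cong (d₂ +_) x) y)))
    offset-compose d₁ d₂ s a b (inj₂ x) (inj₁ y) = inj₂ (inj₁ (trans (xy∙z≈y∙xz d₁ d₂ s)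
      (trans (cong (d₂ +_) x) (trans (sym (+-assoc d₂ a n)) (cong (_+ n) y)))))
    offset-compose d₁ d₂ s a b (inj₂ x) (inj₂ y) = inj₂ (inj₂ (trans (xy∙z≈y∙xz d₁ d₂ s)
      (trans (cong (d₂ +_) x) (trans (sym (+-assoc d₂ a n)) (cong (_+ n) y)))))

    rot-add : (s a b : Fin n) → rot s a + rot a b ≡ rot s b ⊎ rot s a + rot a b ≡ rot s b + n
    rot-add s a b with rot s a + rot a b <? n
    ... | yes sum<n = inj₁ (sym (rot-unique s b _ sum<n sum-offset))
      where
      sum-offset : Offset (rot s a + rot a b) (toℕ s) (toℕ b)
      sum-offset with offset-compose _ _ (toℕ s) (toℕ a) (toℕ b) (proj₂ (rot-offset s a)) (proj₂ (rot-offset a b))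
      ... | inj₁ x = inj₁ x
      ... | inj₂ (inj₁ x) = inj₂ x
      ... | inj₂ (inj₂ x) = ⊥-elim (<⇒≱ (+-mono-< sum<n (toℕ<n s)) (subst (n + n ≤_) (sym x)
               (≤-trans (≤-reflexive (+-comm n n)) (+-monoˡ-≤ n (m≤n+m n (toℕ b))))))
    ... | no sum≮n = inj₂ (trans (sym excess+n) (cong (_+ n) (sym (rot-unique s b excess excess<n excess-offset))))
      where
      excess : ℕ
      excess = rot s a + rot a b ∸ n
      excess+n : excess + n ≡ rot s a + rot a b
      excess+n = m∸n+n≡m (≮⇒≥ sum≮n)
      excess<n : excess < n
      excess<n = +-cancelʳ-< n excess n (subst (_< n + n) (sym excess+n) (+-mono-< (rot<n s a) (rot<n a b)))
      excess-offset : Offset excess (toℕ s) (toℕ b)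
      excess-offset with offset-compose _ _ (toℕ s) (toℕ a) (toℕ b) (proj₂ (rot-offset s a)) (proj₂ (rot-offset a b))
      ... | inj₁ x = ⊥-elim (<⇒≱ (toℕ<n b) (≤-trans (≮⇒≥ sum≮n) (≤-trans (m≤m+n _ (toℕ s)) (≤-reflexive x))))
      ... | inj₂ (inj₁ x) = inj₁ (+-cancelʳ-≡ n _ _ (trans (xy∙z≈xz∙y excess (toℕ s) n) (trans (cong (_+ toℕ s) excess+n) x)))
      ... | inj₂ (inj₂ x) = inj₂ (+-cancelʳ-≡ n _ _ (trans (xy∙z≈xz∙y excess (toℕ s) n) (trans (cong (_+ toℕ s) excess+n) x)))

    rot-via : (s a b : Fin n) → rot s a ≤ rot s b → rot s a + rot a b ≡ rot s b
    rot-via s a b le with rot-add s a b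
    ... | inj₁ x = x
    ... | inj₂ x = ⊥-elim (<⇒≢ (+-mono-≤-< le (rot<n a b)) x)

    rot-wrap : (s a b : Fin n) → rot s b < rot s a → rot s a + rot a b ≡ rot s b + n
    rot-wrap s a b lt with rot-add s a b
    ... | inj₂ x = x
    ... | inj₁ x = ⊥-elim (<⇒≱ lt (≤-trans (m≤m+n (rot s a) (rot a b)) (≤-reflexive x)))

    rot-there-and-back : (a b : Fin n) → a ≢ b → rot a b + rot b a ≡ n
    rot-there-and-back a b a≢b with rot-add a b a
    ... | inj₂ x = trans x (cong (_+ n) (rot-self a))
    ... | inj₁ x = ⊥-elim (a≢b (rot-zero a b (m+n≡0⇒m≡0 _ (trans x (rot-self a)))))

    rot-cycle : (a b c : Fin n) → a ≢ b → rot a b < rot a c → rot b c < rot b a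
    rot-cycle a b c a≢b lt = +-cancelʳ-< (rot a b) _ _
      (subst₂ _<_ (trans (sym (rot-via a b c (<⇒≤ lt))) (+-comm (rot a b) (rot b c)))
                  (trans (sym (rot-there-and-back a b a≢b)) (+-comm (rot a b) (rot b a)))
                  (rot<n a c))

    Between : Fin n → Fin n → Fin n → Set
    Between a x b = 0 < rot a x × rot a x < rot a b

    between-from : (s a x b : Fin n) → rot s a < rot s b → Between a x b → rot s a < rot s x × rot s x < rot s b
    between-from s a x b a<b (pos , x<b) with rot s a ≤? rot s x
    ... | yes a≤x = subst (_< rot s x) (+-identityʳ (rot s a)) (subst (rot s a + 0 <_) (rot-via s a x a≤x) (+-monoʳ-< (rot s a) pos))
                  , subst₂ _<_ (rot-via s a x a≤x) (rot-via s a b (<⇒≤ a<b)) (+-monoʳ-< (rot s a) x<b)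
    ... | no a≰x = ⊥-elim (<⇒≢ too-short (rot-wrap s a x (≰⇒> a≰x)))
      where
      too-short : rot s a + rot a x < rot s x + n
      too-short = <-≤-trans (subst (rot s a + rot a x <_) (rot-via s a b (<⇒≤ a<b)) (+-monoʳ-< (rot s a) x<b))
                            (≤-trans (<⇒≤ (rot<n s b)) (m≤n+m n (rot s x)))

    shift : Fin n → (d : ℕ) → d < n → Fin n
    shift a d d<n with toℕ a + d <? n
    ... | yes p = fromℕ< p
    ... | no p = fromℕ< {toℕ a + d ∸ n} (+-cancelʳ-< n _ _ (subst (_< n + n) (sym (m∸n+n≡m (≮⇒≥ p))) (+-mono-< (toℕ<n a) d<n)))

    rot-shift : (a : Fin n) (d : ℕ) (d<n : d < n) → rot a (shift a d d<n) ≡ d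
    rot-shift a d d<n with toℕ a + d <? n
    ... | yes p = rot-unique a _ d d<n (inj₁ (trans (+-comm d (toℕ a)) (sym (toℕ-fromℕ< p))))
    ... | no p = rot-unique a _ d d<n (inj₂ (trans (+-comm d (toℕ a)) (trans (sym (m∸n+n≡m (≮⇒≥ p))) (cong (_+ n) (sym (toℕ-fromℕ< _))))))

module Residues where
  open import Data.Nat using (ℕ; zero; suc; _+_; _*_; _∸_; _≤_; _<_; _<?_; z≤n; s≤s; NonZero)
  open import Data.Nat.Properties
  open import Data.Nat.DivMod
  open import Data.Nat.Divisibility using (_∣_; divides; ∣m∣n⇒∣m+n; ∣-refl; ∣-trans)
  open import Data.Bool using (Bool; true; false; not; _xor_)
  open import Data.Bool.Properties using (not-involutive; not-distribˡ-xor; xor-identityʳ)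
  open import Data.Sum using (_⊎_; inj₁; inj₂)
  open import Data.Empty using (⊥-elim)
  open import Relation.Nullary using (yes; no)
  open import Relation.Binary.PropositionalEquality

  odd : ℕ → Bool
  odd zero = false
  odd (suc i) = not (odd i)

  odd-+ : ∀ a b → odd (a + b) ≡ odd a xor odd b
  odd-+ zero b = refl
  odd-+ (suc a) b = trans (cong not (odd-+ a b)) (not-distribˡ-xor (odd a) (odd b))

  even⇒¬odd : ∀ J → 2 ∣ J → odd J ≡ false
  even⇒¬odd J (divides q refl) = double q
    where
    double : ∀ q → odd (q * 2) ≡ false
    double zero = refl
    double (suc q) = trans (not-involutive (odd (q * 2))) (double q)

  ¬odd⇒even : ∀ J → odd J ≡ false → 2 ∣ J
  ¬odd⇒even zero _ = divides 0 refl
  ¬odd⇒even (suc zero) ()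
  ¬odd⇒even (suc (suc J)) p = ∣m∣n⇒∣m+n (∣-refl {2}) (¬odd⇒even J (trans (sym (not-involutive (odd J))) p))

  odd⇒positive : ∀ J → odd J ≡ true → 1 ≤ J
  odd⇒positive (suc J) _ = s≤s z≤n

  module Modulo (r : ℕ) {{_ : NonZero r}} (2∣r : 2 ∣ r) where

    -- Multiples of r are even, so adding them preserves parity.
    odd-multiple : ∀ q → odd (q * r) ≡ false
    odd-multiple q = even⇒¬odd (q * r) (∣-trans 2∣r (divides q refl))

    odd-+multiple : ∀ J q → odd (J + q * r) ≡ odd J
    odd-+multiple J q = trans (odd-+ J _) (trans (cong (odd J xor_) (odd-multiple q)) (xor-identityʳ _))

    odd-mod : ∀ i → odd i ≡ odd (i % r)
    odd-mod i = trans (cong odd (m≡m%n+[m/n]*n i r)) (odd-+multiple (i % r) (i / r))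

    odd-r : odd r ≡ false
    odd-r = trans (cong odd (sym (*-identityˡ r))) (odd-multiple 1)

    residue-+multiple : ∀ J q → J < r → (J + q * r) % r ≡ J
    residue-+multiple J q J<r = trans ([m+kn]%n≡m%n J q r) (m<n⇒m%n≡m J<r)

    residue-+r : ∀ i → (i + r) % r ≡ i % r
    residue-+r i = [m+n]%n≡m%n i r

    residue-add : ∀ i t → t < r → ((i + t) % r ≡ i % r + t) ⊎ ((i + t) % r + r ≡ i % r + t)
    residue-add i t t<r with i % r + t <? r
    ... | yes p = inj₁ (trans (%-distribˡ-+ i t r) (trans (cong (λ z → (i % r + z) % r) (m<n⇒m%n≡m t<r)) (m<n⇒m%n≡m p)))
    ... | no p = inj₂ (trans (cong (_+ r) wrapped) (m∸n+n≡m (≮⇒≥ p)))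
      where
      d : ℕ
      d = i % r + t ∸ r
      d<r : d < r
      d<r = +-cancelʳ-< r d r (subst (_< r + r) (sym (m∸n+n≡m (≮⇒≥ p))) (+-mono-< (m%n<n i r) t<r))
      wrapped : (i + t) % r ≡ d
      wrapped = trans (%-distribˡ-+ i t r) (trans (cong (λ z → (i % r + z) % r) (m<n⇒m%n≡m t<r))
                  (trans (cong (_% r) (sym (m∸n+n≡m (≮⇒≥ p)))) (trans ([m+n]%n≡m%n d r) (m<n⇒m%n≡m d<r))))

    residue-inj : ∀ i t u → t < r → u < r → (i + t) % r ≡ (i + u) % r → t ≡ u
    residue-inj i t u t<r u<r e with residue-add i t t<r | residue-add i u u<r
    ... | inj₁ x | inj₁ y = +-cancelˡ-≡ (i % r) t u (trans (sym x) (trans e y))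
    ... | inj₂ x | inj₂ y = +-cancelˡ-≡ (i % r) t u (trans (sym x) (trans (cong (_+ r) e) y))
    ... | inj₁ x | inj₂ y = ⊥-elim (<⇒≱ u<r (subst (r ≤_) (+-cancelˡ-≡ (i % r) _ _ h) (m≤n+m r t)))
      where
      h : i % r + (t + r) ≡ i % r + u
      h = trans (sym (+-assoc (i % r) t r)) (trans (cong (_+ r) (sym x)) (trans (cong (_+ r) e) y))
    ... | inj₂ x | inj₁ y = ⊥-elim (<⇒≱ t<r (subst (r ≤_) (+-cancelˡ-≡ (i % r) _ _ h) (m≤n+m r u)))
      where
      h : i % r + (u + r) ≡ i % r + t
      h = trans (sym (+-assoc (i % r) u r)) (trans (cong (_+ r) (sym y)) (trans (cong (_+ r) (sym e)) x))

    residue-suc : ∀ i → i % r + 1 < r → (i + 1) % r ≡ i % r + 1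
    residue-suc i lt with residue-add i 1 (≤-<-trans (m≤n+m 1 (i % r)) lt)
    ... | inj₁ x = x
    ... | inj₂ x = ⊥-elim (<⇒≱ lt (subst (r ≤_) x (m≤n+m r _)))

    residue-pred : ∀ m → r ≡ suc m → ∀ i → 0 < i % r → (i + m) % r + 1 ≡ i % r
    residue-pred m refl i pos with residue-add i m ≤-refl
    ... | inj₁ x = ⊥-elim (<⇒≱ (m%n<n (i + m) r) (subst (r ≤_) (sym x) (+-monoˡ-≤ m pos)))
    ... | inj₂ x = +-cancelʳ-≡ m _ _ (trans (+-assoc ((i + m) % r) 1 m) x)

module LocalZigzags where
  open import Data.Nat using (ℕ; zero; suc; _+_; _≤_; _<_; z≤n; s≤s; s≤s⁻¹; _≟_)
  open import Data.Nat.Properties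
  open import Data.Bool using (Bool; true; false; not; _∨_)
  open import Data.Fin using (Fin) renaming (_≟_ to _≟F_)
  open import Data.Fin.Subset using (Subset) renaming (_∈_ to _∈ₛ_)
  open import Data.Vec using (Vec; []; _∷_; _∷ʳ_; head; last; tabulate)
  open import Data.Vec.Properties using (∷-injective; []=⇒lookup; lookup⇒[]=; lookup∘tabulate)
  open import Data.List.Membership.Propositional using (_∈_)
  open import Data.Product using (Σ; _×_; _,_; proj₁; proj₂; Σ-syntax)
  open import Data.Empty using (⊥; ⊥-elim)
  open import Data.Unit using (⊤)
  open import Relation.Binary.PropositionalEquality
  open import Relation.Nullary using (yes; no; does)
  open import Function.Bundles using (_⇔_; mk⇔)
  open import Defs
  open ClockwiseDistance
  open Residues using (odd)

  window : ∀ {a} {A : Set a} (j : ℕ) → (ℕ → A) → ℕ → Vec A j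
  window zero v i = []
  window (suc j) v i = v i ∷ window j v (suc i)

  window-snoc : ∀ {a} {A : Set a} (j : ℕ) (v : ℕ → A) i → window (suc j) v i ≡ window j v i ∷ʳ v (i + j)
  window-snoc zero v i = cong (λ z → v z ∷ []) (sym (+-identityʳ i))
  window-snoc (suc j) v i =
    cong (v i ∷_) (trans (window-snoc j v (suc i)) (cong (λ z → window j v (suc i) ∷ʳ v z) (sym (+-suc i j))))

  window-last : ∀ {a} {A : Set a} (j : ℕ) (v : ℕ → A) i → last (window (suc j) v i) ≡ v (i + j)
  window-last zero v i = cong v (sym (+-identityʳ i))
  window-last (suc j) v i = trans (window-last j v (suc i)) (cong v (sym (+-suc i j)))

  window-ext : ∀ {a} {A : Set a} (j : ℕ) (v v' : ℕ → A) i → (∀ t → t < j → v' (i + t) ≡ v (i + t)) →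
               window j v' i ≡ window j v i
  window-ext zero v v' i e = refl
  window-ext (suc j) v v' i e =
    cong₂ _∷_ (trans (cong v' (sym (+-identityʳ i))) (trans (e 0 (s≤s z≤n)) (cong v (+-identityʳ i))))
              (window-ext j v v' (suc i) (λ t t<j → trans (cong v' (sym (+-suc i t)))
                                                     (trans (e (suc t) (s≤s t<j)) (cong v (+-suc i t)))))

  update : ∀ {a} {A : Set a} → (ℕ → A) → ℕ → A → ℕ → A
  update v a y i with i ≟ a
  ... | yes _ = y
  ... | no _ = v i

  update-here : ∀ {a} {A : Set a} (v : ℕ → A) b y → update v b y b ≡ y
  update-here v b y with b ≟ b
  ... | yes _ = refl
  ... | no b≢b = ⊥-elim (b≢b refl)

  update-elsewhere : ∀ {a} {A : Set a} (v : ℕ → A) b y i → i ≢ b → update v b y i ≡ v i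
  update-elsewhere v b y i i≢b with i ≟ b
  ... | yes i≡b = ⊥-elim (i≢b i≡b)
  ... | no _ = refl

  occurs : ∀ {N j} → Fin N → Vec (Fin N) j → Bool
  occurs x [] = false
  occurs x (y ∷ w) = does (x ≟F y) ∨ occurs x w

  pointSet : ∀ {N j} → Vec (Fin N) j → Subset N
  pointSet w = tabulate (λ x → occurs x w)

  ∈-pointSet : ∀ {N j} (x : Fin N) (w : Vec (Fin N) j) → (x ∈ₛ pointSet w) ⇔ (occurs x w ≡ true)
  ∈-pointSet x w = mk⇔ (λ p → trans (sym (lookup∘tabulate (λ z → occurs z w) x)) ([]=⇒lookup p))
                       (λ e → lookup⇒[]= x (pointSet w) (trans (lookup∘tabulate (λ z → occurs z w) x) e))

  occurs-window : ∀ {N} (j : ℕ) (v : ℕ → Fin N) i x → (occurs x (window j v i) ≡ true) ⇔ (Σ[ t ∈ ℕ ] (t < j × v (i + t) ≡ x))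
  occurs-window j v i x = mk⇔ (to j i) (from j i)
    where
    to : ∀ j i → occurs x (window j v i) ≡ true → Σ[ t ∈ ℕ ] (t < j × v (i + t) ≡ x)
    to zero i ()
    to (suc j) i e with x ≟F v i
    ... | yes x≡vi = 0 , s≤s z≤n , trans (cong v (+-identityʳ i)) (sym x≡vi)
    ... | no _ with to j (suc i) e
    ...   | t , t<j , vt≡x = suc t , s≤s t<j , trans (cong v (+-suc i t)) vt≡x
    from : ∀ j i → Σ[ t ∈ ℕ ] (t < j × v (i + t) ≡ x) → occurs x (window j v i) ≡ true
    from (suc j) i (zero , _ , vi≡x) with x ≟F v i
    ... | yes _ = refl
    ... | no x≢vi = ⊥-elim (x≢vi (trans (sym vi≡x) (cong v (+-identityʳ i))))
    from (suc j) i (suc t , s≤s t<j , vt≡x) with x ≟F v i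
    ... | yes _ = refl
    ... | no _ = from j (suc i) (t , t<j , trans (cong v (sym (+-suc i t))) vt≡x)

  Increasing : ∀ {N} → (Fin N → ℕ) → ℕ → ∀ {j} → Vec (Fin N) j → Set
  Increasing f p [] = ⊤
  Increasing f p (y ∷ g) = p < f y × Increasing f (f y) g

  Clockwise : ∀ {N j} → Vec (Fin N) j → Set
  Clockwise [] = ⊤
  Clockwise (a ∷ g) = Increasing (rot a) 0 g

  increasing-above : ∀ {N} (f : Fin N → ℕ) p j (v : ℕ → Fin N) i → Increasing f p (window j v i) →
                     ∀ t → t < j → p < f (v (i + t))
  increasing-above f p (suc j) v i (p<fvi , rest) zero _ = subst (λ z → p < f (v z)) (sym (+-identityʳ i)) p<fvi
  increasing-above f p (suc j) v i (p<fvi , rest) (suc t) (s≤s t<j) =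
    <-trans p<fvi (subst (λ z → f (v i) < f (v z)) (sym (+-suc i t)) (increasing-above f (f (v i)) j v (suc i) rest t t<j))

  increasing-mono : ∀ {N} (f : Fin N → ℕ) p j (v : ℕ → Fin N) i → Increasing f p (window j v i) →
                    ∀ t u → t < u → u < j → f (v (i + t)) < f (v (i + u))
  increasing-mono f p (suc j) v i (_ , rest) zero (suc u) _ (s≤s u<j) =
    subst₂ (λ z₁ z₂ → f (v z₁) < f (v z₂)) (sym (+-identityʳ i)) (sym (+-suc i u)) (increasing-above f (f (v i)) j v (suc i) rest u u<j)
  increasing-mono f p (suc j) v i (_ , rest) (suc t) (suc u) (s≤s t<u) (s≤s u<j) =
    subst₂ (λ z₁ z₂ → f (v z₁) < f (v z₂)) (sym (+-suc i t)) (sym (+-suc i u)) (increasing-mono f (f (v i)) j v (suc i) rest t u t<u u<j)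

  module Local (n m' : ℕ) (H : CGH n (suc (suc m'))) where
    m r : ℕ
    m = suc m'
    r = suc m

    OrientedEdge : Vec (Fin n) r → Set
    OrientedEdge w = Clockwise w × pointSet w ∈ edges H

    -- A local zigzag of length ℓ: each window v_i … v_{i+m} (i < ℓ) is an oriented
    -- edge, and each new vertex v_{i+r} is placed between two vertices of the
    -- previous window: between v_i and v_{i+1} for even i, and between v_{i+m}
    -- and v_i for odd i.  `LocalToGlobal.FromLocal.zigzag` shows these local
    -- conditions already force a k-zigzag.
    record LocalZigzag (v : ℕ → Fin n) (ℓ : ℕ) : Set where
      field
        edge : ∀ i → i < ℓ → OrientedEdge (window r v i)
        step : ∀ i → suc i < ℓ → (odd i ≡ false → Between (v i) (v (i + r)) (v (suc i))) ×
                                 (odd i ≡ true → Between (v (i + m)) (v (i + r)) (v i))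

    -- Chain l w p: some local zigzag of length l ends in the window w, and its
    -- last index l - 1 has parity p.
    Chain : ℕ → Vec (Fin n) r → Bool → Set
    Chain zero w p = ⊥
    Chain (suc l) w p = Σ (ℕ → Fin n) λ v → LocalZigzag v (suc l) × window r v l ≡ w × odd l ≡ p

    Extends : Bool → Fin n → Vec (Fin n) m → Fin n → Set
    Extends false a g y = Between a y (head g)
    Extends true a g y = Between (last g) y a

    module Extension (l : ℕ) (a : Fin n) (g : Vec (Fin n) m) (y : Fin n) (p : Bool)
                     (v : ℕ → Fin n) (zz : LocalZigzag v (suc l)) (ends : window r v l ≡ a ∷ g) (parity : odd l ≡ p)
                     (placed : Extends p a g y) where
      open LocalZigzag zz

      v' : ℕ → Fin n
      v' = update v (l + r) y

      agrees : ∀ i → i < l + r → v' i ≡ v i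
      agrees i i<l+r = update-elsewhere v (l + r) y i (<⇒≢ i<l+r)

      v'-first : v' l ≡ a
      v'-first = trans (agrees l (m<m+n l (s≤s z≤n))) (proj₁ (∷-injective ends))

      v'-second : v' (suc l) ≡ head g
      v'-second = trans (agrees (suc l) (subst (_< l + r) (+-comm l 1) (+-monoʳ-< l (s≤s (s≤s z≤n)))))
                        (cong head (proj₂ (∷-injective ends)))

      v'-last : v' (l + m) ≡ last g
      v'-last = trans (agrees (l + m) (+-monoʳ-< l ≤-refl))
                      (trans (sym (window-last m v l)) (cong last ends))

      v'-new : v' (l + r) ≡ y
      v'-new = update-here v (l + r) y

      new-window : window r v' (suc l) ≡ g ∷ʳ y
      new-window = trans (window-snoc m v' (suc l))
        (cong₂ _∷ʳ_ (trans (window-ext m v v' (suc l) (λ t t<m → agrees (suc l + t) (subst (suc l + t <_) (sym (+-suc l m)) (+-monoʳ-< (suc l) t<m))))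
                           (proj₂ (∷-injective ends)))
                    (trans (cong v' (sym (+-suc l m))) v'-new))

      old-window : ∀ i → i ≤ l → window r v' i ≡ window r v i
      old-window i i≤l = window-ext r v v' i (λ t t<r → agrees (i + t) (+-mono-≤-< i≤l t<r))

      edges' : OrientedEdge (g ∷ʳ y) → ∀ i → i < suc (suc l) → OrientedEdge (window r v' i)
      edges' new-edge i i<l+2 with i ≟ suc l
      ... | yes refl = subst OrientedEdge (sym new-window) new-edge
      ... | no i≢l+1 = subst OrientedEdge (sym (old-window i (s≤s⁻¹ i≤l))) (edge i i≤l)
        where
        i≤l : i < suc l
        i≤l = ≤∧≢⇒< (s≤s⁻¹ i<l+2) i≢l+1

      new-step : (odd l ≡ false → Between (v' l) (v' (l + r)) (v' (suc l))) ×
                 (odd l ≡ true → Between (v' (l + m)) (v' (l + r)) (v' l))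
      new-step = (λ l-even → subst₂ (λ b c → Between b (v' (l + r)) c) (sym v'-first) (sym v'-second)
                              (subst (λ z → Between a z (head g)) (sym v'-new) (placed-as (trans (sym parity) l-even))))
               , (λ l-odd → subst₂ (λ b c → Between b (v' (l + r)) c) (sym v'-last) (sym v'-first)
                              (subst (λ z → Between (last g) z a) (sym v'-new) (placed-as (trans (sym parity) l-odd))))
        where
        placed-as : ∀ {q} → p ≡ q → Extends q a g y
        placed-as refl = placed

      -- Earlier step conditions only involve entries below l + r.
      old-step : ∀ i → i < l → (odd i ≡ false → Between (v' i) (v' (i + r)) (v' (suc i))) ×
                                (odd i ≡ true → Between (v' (i + m)) (v' (i + r)) (v' i))
      old-step i i<l = (λ i-even → subst₃ (agrees i i<l+r) (agrees (i + r) i+r<l+r) (agrees (suc i) suc-i<) (proj₁ old i-even))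
                     , (λ i-odd → subst₃ (agrees (i + m) (below m (n≤1+n m))) (agrees (i + r) i+r<l+r) (agrees i i<l+r) (proj₂ old i-odd))
        where
        old : (odd i ≡ false → Between (v i) (v (i + r)) (v (suc i))) × (odd i ≡ true → Between (v (i + m)) (v (i + r)) (v i))
        old = step i (s≤s i<l)
        i+r<l+r : i + r < l + r
        i+r<l+r = +-monoˡ-< r i<l
        below : ∀ t → t ≤ r → i + t < l + r
        below t t≤r = ≤-<-trans (+-monoʳ-≤ i t≤r) i+r<l+r
        i<l+r : i < l + r
        i<l+r = subst (_< l + r) (+-identityʳ i) (below 0 z≤n)
        suc-i< : suc i < l + r
        suc-i< = subst (_< l + r) (+-comm i 1) (below 1 (s≤s z≤n))
        subst₃ : ∀ {b b' x x' c c'} → b' ≡ b → x' ≡ x → c' ≡ c → Between b x c → Between b' x' c'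
        subst₃ refl refl refl btw = btw

      steps' : ∀ i → suc i < suc (suc l) → (odd i ≡ false → Between (v' i) (v' (i + r)) (v' (suc i))) ×
                                           (odd i ≡ true → Between (v' (i + m)) (v' (i + r)) (v' i))
      steps' i i+1<l+2 with i ≟ l
      ... | yes refl = new-step
      ... | no i≢l = old-step i (≤∧≢⇒< (s≤s⁻¹ (s≤s⁻¹ i+1<l+2)) i≢l)

    extend : ∀ l a g y p → Chain (suc l) (a ∷ g) p → OrientedEdge (g ∷ʳ y) → Extends p a g y →
             Chain (suc (suc l)) (g ∷ʳ y) (not p)
    extend l a g y p (v , zz , ends , parity) new-edge placed =
      v' , record { edge = edges' new-edge ; step = steps' } , new-window , cong not parity
      where open Extension l a g y p v zz ends parity placed

module LocalToGlobal where
  open import Data.Nat using (ℕ; zero; suc; _+_; _*_; _∸_; _≤_; _<_; z≤n; s≤s; s≤s⁻¹; _≟_)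
  open import Data.Nat.Properties
  open import Data.Nat.DivMod
  open import Data.Nat.Divisibility using (_∣_)
  open import Data.Bool using (true; false; not; if_then_else_)
  open import Data.Fin using (Fin; toℕ)
  open import Data.Fin.Properties using (toℕ<n)
  open import Data.Product using (Σ; _×_; _,_; proj₁; proj₂)
  open import Data.Sum using (inj₁; inj₂)
  open import Data.Empty using (⊥-elim)
  open import Relation.Binary.PropositionalEquality
  open import Relation.Binary using (tri<; tri≈; tri>)
  open import Relation.Nullary using (yes; no; ¬_; Dec)
  open import Function.Bundles using (Equivalence; mk⇔)
  open import Defs
  open ClockwiseDistance
  open Residues
  open LocalZigzags

  iterate : (g : ℕ → ℕ) (_∼_ : ℕ → ℕ → Set) → (∀ {a b c} → a ∼ b → b ∼ c → a ∼ c) →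
            (Range : ℕ → Set) → (∀ q → Range (suc q) → Range q) → (∀ q → Range (suc q) → g q ∼ g (suc q)) →
            ∀ q₁ q₂ → q₁ < q₂ → Range q₂ → g q₁ ∼ g q₂
  iterate g _∼_ trans∼ Range down step q₁ (suc q) q₁<q+1 range with q₁ ≟ q
  ... | yes refl = step q range
  ... | no q₁≢q = trans∼ (iterate g _∼_ trans∼ Range down step q₁ q (≤∧≢⇒< (s≤s⁻¹ q₁<q+1) q₁≢q) (down q range)) (step q range)

  weakly : (_∼_ : ℕ → ℕ → Set) → (∀ {q} → q ∼ q) → ∀ {q₁ q₂} → (q₁ < q₂ → q₁ ∼ q₂) → q₁ ≤ q₂ → q₁ ∼ q₂
  weakly _∼_ refl∼ strict q₁≤q₂ with m≤n⇒m<n∨m≡n q₁≤q₂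
  ... | inj₁ q₁<q₂ = strict q₁<q₂
  ... | inj₂ refl = refl∼

  -- Measuring positions clockwise from v₀, the key invariant is
  -- that inside every window the order of the positions agrees with the order
  -- of the indices' residues mod r; the segment I_J is then spanned by the
  -- vertices with index ≡ J (mod r).
  module _ (n m' K : ℕ) (H : CGH n (suc (suc m'))) (2∣r : 2 ∣ suc (suc m')) where
    open Local n m' H
    open Modulo r 2∣r

    odd-m : odd m ≡ true
    odd-m with odd m in e
    ... | true = refl
    ... | false = ⊥-elim (false≢true (trans (sym odd-r) (cong not e)))
      where
      false≢true : false ≢ true
      false≢true ()

    even⇒residue<m : ∀ i → odd i ≡ false → i % r + 1 < r
    even⇒residue<m i even = subst (_< r) (+-comm 1 (i % r)) (s≤s (≤∧≢⇒< (s≤s⁻¹ (m%n<n i r)) not-last))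
      where
      not-last : i % r ≢ m
      not-last e with trans (sym even) (trans (odd-mod i) (trans (cong odd e) odd-m))
      ... | ()

    odd⇒residue>0 : ∀ i → odd i ≡ true → 0 < i % r
    odd⇒residue>0 i i-odd with i % r in e
    ... | zero with trans (sym i-odd) (trans (odd-mod i) (cong odd e))
    ...   | ()
    odd⇒residue>0 i i-odd | suc _ = s≤s z≤n

    module FromLocal (v : ℕ → Fin n) (zz : LocalZigzag v (suc K)) where
      open LocalZigzag zz

      ρ : Fin n → ℕ
      ρ x = rot (v 0) x

      ResidueOrdered : ℕ → Set
      ResidueOrdered i = ∀ t u → t < r → u < r → (i + t) % r < (i + u) % r → ρ (v (i + t)) < ρ (v (i + u))

      -- The first window is an oriented edge starting at v₀.
      ordered-first : ResidueOrdered 0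
      ordered-first t u t<r u<r lt = go t u (subst₂ _<_ (m<n⇒m%n≡m t<r) (m<n⇒m%n≡m u<r) lt) u<r
        where
        clockwise₀ : Increasing (rot (v 0)) 0 (window m v 1)
        clockwise₀ = proj₁ (edge 0 (s≤s z≤n))
        go : ∀ t u → t < u → u < r → ρ (v t) < ρ (v u)
        go zero (suc u) _ (s≤s u<m) = subst (_< ρ (v (suc u))) (sym (rot-self (v 0))) (increasing-above (rot (v 0)) 0 m v 1 clockwise₀ u u<m)
        go (suc t) (suc u) (s≤s t<u) (s≤s u<m) = increasing-mono (rot (v 0)) 0 m v 1 clockwise₀ t u t<u u<m

      StepPositions : ℕ → Set
      StepPositions i = (odd i ≡ false → ρ (v i) < ρ (v (i + r)) × ρ (v (i + r)) < ρ (v (suc i))) ×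
                        (odd i ≡ true → ρ (v (i + m)) < ρ (v (i + r)) × ρ (v (i + r)) < ρ (v i))

      step-positions : ∀ i → suc i < suc K → ResidueOrdered i → StepPositions i
      step-positions i i+1<k ordered = even-case , odd-case
        where
        even-case : odd i ≡ false → ρ (v i) < ρ (v (i + r)) × ρ (v (i + r)) < ρ (v (suc i))
        even-case even = between-from (v 0) (v i) (v (i + r)) (v (suc i)) vi<vi+1 (proj₁ (step i i+1<k) even)
          where
          next : (i + 1) % r ≡ i % r + 1
          next = residue-suc i (even⇒residue<m i even)
          vi<vi+1 : ρ (v i) < ρ (v (suc i))
          vi<vi+1 = subst₂ (λ a b → ρ (v a) < ρ (v b)) (+-identityʳ i) (+-comm i 1)
                      (ordered 0 1 (s≤s z≤n) (s≤s (s≤s z≤n))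
                        (subst₂ _<_ (cong (_% r) (sym (+-identityʳ i))) (sym next) (subst (i % r <_) (+-comm 1 (i % r)) ≤-refl)))
        odd-case : odd i ≡ true → ρ (v (i + m)) < ρ (v (i + r)) × ρ (v (i + r)) < ρ (v i)
        odd-case i-odd = between-from (v 0) (v (i + m)) (v (i + r)) (v i) vi+m<vi (proj₂ (step i i+1<k) i-odd)
          where
          prev : (i + m) % r + 1 ≡ i % r
          prev = residue-pred m refl i (odd⇒residue>0 i i-odd)
          vi+m<vi : ρ (v (i + m)) < ρ (v i)
          vi+m<vi = subst (λ a → ρ (v (i + m)) < ρ (v a)) (+-identityʳ i)
                      (ordered m 0 ≤-refl (s≤s z≤n)
                        (subst ((i + m) % r <_) (cong (_% r) (sym (+-identityʳ i)))
                          (subst ((i + m) % r <_) (trans (+-comm 1 ((i + m) % r)) prev) (n<1+n ((i + m) % r)))))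

      -- Passing from window i to window i + 1: the new vertex v_{i+r} inherits
      -- the residue c = i % r of the dropped vertex v_i, and the step condition
      -- places it correctly relative to all other vertices of the window.
      module Step (i : ℕ) (i+1<k : suc i < suc K) (ordered : ResidueOrdered i) where
        steps : StepPositions i
        steps = step-positions i i+1<k ordered
        c : ℕ
        c = i % r

        residue-i+0 : (i + 0) % r ≡ c
        residue-i+0 = cong (_% r) (+-identityʳ i)

        new-below : ∀ u → suc u < r → c < (i + suc u) % r → ρ (v (i + r)) < ρ (v (i + suc u))
        new-below u u+1<r c< with odd i in parity
        ... | true = <-trans (proj₂ (proj₂ steps parity))
                       (subst (λ a → ρ (v a) < ρ (v (i + suc u))) (+-identityʳ i)
                         (ordered 0 (suc u) (s≤s z≤n) u+1<r (subst (_< (i + suc u) % r) (sym residue-i+0) c<)))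
        ... | false = via-next u c< u+1<r
          where
          next : (i + 1) % r ≡ c + 1
          next = residue-suc i (even⇒residue<m i parity)
          via-next : ∀ w → c < (i + suc w) % r → suc w < r → ρ (v (i + r)) < ρ (v (i + suc w))
          via-next zero _ _ = subst (λ a → ρ (v (i + r)) < ρ (v a)) (+-comm 1 i) (proj₂ (proj₁ steps parity))
          via-next (suc w) c< w+2<r = <-trans (proj₂ (proj₁ steps parity))
            (subst (λ a → ρ (v a) < ρ (v (i + suc (suc w)))) (+-comm i 1)
              (ordered 1 (suc (suc w)) (s≤s (s≤s z≤n)) w+2<r next<))
            where
            distinct : (i + 1) % r ≢ (i + suc (suc w)) % r
            distinct e with residue-inj i 1 (suc (suc w)) (s≤s (s≤s z≤n)) w+2<r e
            ... | ()
            next< : (i + 1) % r < (i + suc (suc w)) % r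
            next< = ≤∧≢⇒< (subst (_≤ (i + suc (suc w)) % r) (trans (+-comm 1 c) (sym next)) c<) distinct

        new-above : ∀ t → suc t < r → (i + suc t) % r < c → ρ (v (i + suc t)) < ρ (v (i + r))
        new-above t t+1<r <c with odd i in parity
        ... | false = <-trans (subst (λ a → ρ (v (i + suc t)) < ρ (v a)) (+-identityʳ i)
                                (ordered (suc t) 0 t+1<r (s≤s z≤n) (subst ((i + suc t) % r <_) (sym residue-i+0) <c)))
                              (proj₁ (proj₁ steps parity))
        ... | true with suc t ≟ m
        ...   | yes refl = proj₁ (proj₂ steps parity)
        ...   | no t+1≢m = <-trans (ordered (suc t) m t+1<r ≤-refl below-prev) (proj₁ (proj₂ steps parity))
          where
          prev : (i + m) % r + 1 ≡ c
          prev = residue-pred m refl i (odd⇒residue>0 i parity)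
          distinct : (i + suc t) % r ≢ (i + m) % r
          distinct e = t+1≢m (residue-inj i (suc t) m t+1<r ≤-refl e)
          below-prev : (i + suc t) % r < (i + m) % r
          below-prev = ≤∧≢⇒< (s≤s⁻¹ (subst ((i + suc t) % r <_) (trans (sym prev) (+-comm _ 1)) <c)) distinct

      ordered-step : ∀ i → suc i < suc K → ResidueOrdered i → ResidueOrdered (suc i)
      ordered-step i i+1<k ordered t u t<r u<r lt = compare (t ≟ m) (u ≟ m)
        where
        open Step i i+1<k ordered
        shifted : ∀ t → suc i + t ≡ i + suc t
        shifted t = sym (+-suc i t)
        shift-≢m : ∀ {t} → t < r → t ≢ m → suc t < r
        shift-≢m t<r t≢m = s≤s (≤∧≢⇒< (s≤s⁻¹ t<r) t≢m)
        in-positions : ∀ {a b a' b'} → a ≡ a' → b ≡ b' → ρ (v a') < ρ (v b') → ρ (v a) < ρ (v b)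
        in-positions refl refl lt = lt
        compare : Dec (t ≡ m) → Dec (u ≡ m) → ρ (v (suc i + t)) < ρ (v (suc i + u))
        compare (yes refl) (yes refl) = ⊥-elim (<-irrefl refl lt)
        compare (no t≢m) (no u≢m) = in-positions (shifted t) (shifted u)
          (ordered (suc t) (suc u) (shift-≢m t<r t≢m) (shift-≢m u<r u≢m) (subst₂ (λ a b → a % r < b % r) (shifted t) (shifted u) lt))
        compare (yes refl) (no u≢m) = in-positions (shifted m) (shifted u)
          (new-below u (shift-≢m u<r u≢m) (subst₂ _<_ (trans (cong (_% r) (shifted m)) (residue-+r i)) (cong (_% r) (shifted u)) lt))
        compare (no t≢m) (yes refl) = in-positions (shifted t) (shifted m)
          (new-above t (shift-≢m t<r t≢m) (subst₂ _<_ (cong (_% r) (shifted t)) (trans (cong (_% r) (shifted m)) (residue-+r i)) lt))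

      ordered-all : ∀ i → i < suc K → ResidueOrdered i
      ordered-all zero _ = ordered-first
      ordered-all (suc i) i+1<k = ordered-step i i+1<k (ordered-all i (<-trans (n<1+n i) i+1<k))

      track : ℕ → ℕ → ℕ
      track J q = ρ (v (J + q * r))

      InRange : ℕ → ℕ → Set
      InRange J q = J + q * r ≤ K + m

      +r : ∀ J q → J + suc q * r ≡ (J + q * r) + r
      +r J q = trans (cong (J +_) (+-comm r (q * r))) (sym (+-assoc J (q * r) r))

      -- One step in a class is a step condition read in positions.
      track-step : ∀ J q → InRange J (suc q) → (odd J ≡ false → track J q < track J (suc q)) ×
                                              (odd J ≡ true → track J (suc q) < track J q)
      track-step J q in-range = (λ even → subst (λ a → track J q < ρ (v a)) (sym (+r J q)) (proj₁ (proj₁ steps (trans same-parity even))))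
                              , (λ J-odd → subst (λ a → ρ (v a) < track J q) (sym (+r J q)) (proj₂ (proj₂ steps (trans same-parity J-odd))))
        where
        i : ℕ
        i = J + q * r
        i<K : i < K
        i<K = +-cancelʳ-≤ m _ _ (subst (_≤ K + m) (trans (+r J q) (+-suc i m)) in-range)
        steps : StepPositions i
        steps = step-positions i (s≤s i<K) (ordered-all i (≤-trans i<K (n≤1+n K)))
        same-parity : odd i ≡ odd J
        same-parity = odd-+multiple J q

      in-range-pred : ∀ J q → InRange J (suc q) → InRange J q
      in-range-pred J q in-range = ≤-trans (+-monoʳ-≤ J (m≤n+m (q * r) r)) in-range

      track-increasing : ∀ J → odd J ≡ false → ∀ q₁ q₂ → q₁ < q₂ → InRange J q₂ → track J q₁ < track J q₂
      track-increasing J even = iterate (track J) _<_ <-trans (InRange J) (in-range-pred J) (λ q b → proj₁ (track-step J q b) even)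

      track-decreasing : ∀ J → odd J ≡ true → ∀ q₁ q₂ → q₁ < q₂ → InRange J q₂ → track J q₂ < track J q₁
      track-decreasing J J-odd = iterate (track J) (λ a b → b < a) (λ x y → <-trans y x) (InRange J) (in-range-pred J)
                                         (λ q b → proj₂ (track-step J q b) J-odd)

      lastRound : ℕ → ℕ
      lastRound J = (K + m ∸ J) / r

      J≤K+m : ∀ J → J < r → J ≤ K + m
      J≤K+m J J<r = ≤-trans (s≤s⁻¹ J<r) (m≤n+m m K)

      lastRound-in-range : ∀ J → J < r → InRange J (lastRound J)
      lastRound-in-range J J<r = ≤-trans (+-monoʳ-≤ J (m/n*n≤m (K + m ∸ J) r))
                                         (≤-reflexive (trans (+-comm J _) (m∸n+n≡m (J≤K+m J J<r))))

      lastRound-max : ∀ J q → J < r → InRange J q → q ≤ lastRound J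
      lastRound-max J q J<r in-range = ≤-trans (≤-reflexive (sym (m*n/n≡m q r)))
        (/-monoˡ-≤ r (+-cancelʳ-≤ J _ _ (subst (q * r + J ≤_) (sym (m∸n+n≡m (J≤K+m J J<r)))
                                           (subst (_≤ K + m) (+-comm J (q * r)) in-range))))

      lastRound-beyond-K : ∀ J → J < r → K ≤ J + lastRound J * r
      lastRound-beyond-K J J<r = s≤s⁻¹ (+-cancelʳ-≤ m (suc K) (suc (J + lastRound J * r)) (begin
        suc (K + m)                              ≡⟨ cong suc (sym (m∸n+n≡m (J≤K+m J J<r))) ⟩
        suc (X + J)                              ≤⟨ +-monoˡ-≤ J X<next ⟩
        lastRound J * r + r + J                  ≡⟨ rearrange ⟩
        suc (J + lastRound J * r) + m            ∎))
        where
        open ≤-Reasoning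
        X : ℕ
        X = K + m ∸ J
        X<next : X < lastRound J * r + r
        X<next = subst (_< lastRound J * r + r) (sym (trans (m≡m%n+[m/n]*n X r) (+-comm (X % r) _)))
                       (+-monoʳ-< (lastRound J * r) (m%n<n X r))
        rearrange : lastRound J * r + r + J ≡ suc (J + lastRound J * r) + m
        rearrange = trans (+-comm (lastRound J * r + r) J) (trans (sym (+-assoc J (lastRound J * r) r))
                      (trans (+-comm (J + lastRound J * r) r) (cong suc (+-comm m _))))

      segment-lo segment-hi : ℕ → ℕ
      segment-lo J = if odd J then track J (lastRound J) else track J 0
      segment-hi J = if odd J then track J 0 else track J (lastRound J)

      in-range-0 : ∀ J → J < r → InRange J 0
      in-range-0 J J<r = subst (_≤ K + m) (sym (+-identityʳ J)) (J≤K+m J J<r)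

      in-segment : ∀ J → J < r → ∀ q → InRange J q → segment-lo J ≤ track J q × track J q ≤ segment-hi J
      in-segment J J<r q in-range with odd J in parity
      ... | false = weakly up ≤-refl (λ lt → <⇒≤ (track-increasing J parity 0 q lt in-range)) z≤n
                  , weakly up ≤-refl (λ lt → <⇒≤ (track-increasing J parity q (lastRound J) lt (lastRound-in-range J J<r)))
                           (lastRound-max J q J<r in-range)
        where
        up : ℕ → ℕ → Set
        up a b = track J a ≤ track J b
      ... | true = weakly down ≤-refl (λ lt → <⇒≤ (track-decreasing J parity q (lastRound J) lt (lastRound-in-range J J<r)))
                          (lastRound-max J q J<r in-range)
                 , weakly down ≤-refl (λ lt → <⇒≤ (track-decreasing J parity 0 q lt in-range)) z≤n
        where
        down : ℕ → ℕ → Set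
        down a b = track J b ≤ track J a

      segment-nonempty : ∀ J → J < r → segment-lo J ≤ segment-hi J
      segment-nonempty J J<r = ≤-trans (proj₁ (in-segment J J<r 0 (in-range-0 J J<r))) (proj₂ (in-segment J J<r 0 (in-range-0 J J<r)))

      last-in-final-window : ∀ J → J < r → Σ ℕ λ t → t < r × J + lastRound J * r ≡ K + t × (K + t) % r ≡ J
      last-in-final-window J J<r = t , t<r , sym K+t≡ , trans (cong (_% r) K+t≡) (residue-+multiple J (lastRound J) J<r)
        where
        t : ℕ
        t = J + lastRound J * r ∸ K
        K+t≡ : K + t ≡ J + lastRound J * r
        K+t≡ = m+[n∸m]≡n (lastRound-beyond-K J J<r)
        t<r : t < r
        t<r = s≤s (subst (t ≤_) (m+n∸m≡n K m) (∸-monoˡ-≤ K (lastRound-in-range J J<r)))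

      -- Consecutive segments are disjoint and in clockwise order: an even class
      -- ends and the next (odd) class starts in the final window; an odd class
      -- ends and the next (even) class starts in the first window.
      segments-adjacent : ∀ J → suc J < r → segment-hi J < segment-lo (suc J)
      segments-adjacent J J+1<r = by-parity (odd J) refl
        where
        J<r : J < r
        J<r = <-trans (n<1+n J) J+1<r
        by-parity : ∀ b → odd J ≡ b → segment-hi J < segment-lo (suc J)
        by-parity false parity rewrite parity with last-in-final-window J J<r | last-in-final-window (suc J) J+1<r
        ... | t₁ , t₁<r , e₁ , c₁ | t₂ , t₂<r , e₂ , c₂ =
          subst₂ (λ x y → ρ (v x) < ρ (v y)) (sym e₁) (sym e₂)
            (ordered-all K (n<1+n K) t₁ t₂ t₁<r t₂<r (subst₂ _<_ (sym c₁) (sym c₂) (n<1+n J)))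
        by-parity true parity rewrite parity =
          subst₂ (λ x y → ρ (v x) < ρ (v y)) (sym (+-identityʳ J)) (sym (+-identityʳ (suc J)))
            (ordered-first J (suc J) J<r J+1<r (subst₂ _<_ (sym (m<n⇒m%n≡m J<r)) (sym (m<n⇒m%n≡m J+1<r)) (n<1+n J)))

      segments-ordered : ∀ J J' → J < J' → J' < r → segment-hi J < segment-lo J'
      segments-ordered J (suc J') (s≤s J≤J') J'+1<r with J ≟ J'
      ... | yes refl = segments-adjacent J J'+1<r
      ... | no J≢J' = <-≤-trans (segments-ordered J J' (≤∧≢⇒< J≤J' J≢J') J'<r)
                        (≤-trans (segment-nonempty J' J'<r) (<⇒≤ (segments-adjacent J' J'+1<r)))
        where
        J'<r : J' < r
        J'<r = <-trans (n<1+n J') J'+1<r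

      decompose : ∀ i → i ≡ i % r + (i / r) * r
      decompose i = m≡m%n+[m/n]*n i r

      index-in-range : ∀ i → i < K + r → InRange (i % r) (i / r)
      index-in-range i i<K+r = subst (_≤ K + m) (decompose i) (s≤s⁻¹ (subst (i <_) (+-suc K m) i<K+r))

      track-index : ∀ i → track (i % r) (i / r) ≡ ρ (v i)
      track-index i = cong (λ z → ρ (v z)) (sym (decompose i))

      different-classes : ∀ i j → i < K + r → j < K + r → i % r < j % r → ρ (v i) < ρ (v j)
      different-classes i j i< j< lt = subst₂ _<_ (track-index i) (track-index j)
        (≤-<-trans (proj₂ (in-segment (i % r) (m%n<n i r) (i / r) (index-in-range i i<)))
          (<-≤-trans (segments-ordered (i % r) (j % r) lt (m%n<n j r))
                     (proj₁ (in-segment (j % r) (m%n<n j r) (j / r) (index-in-range j j<)))))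

      same-class : ∀ i j → i < K + r → j < K + r → i % r ≡ j % r → i / r < j / r → ρ (v i) ≢ ρ (v j)
      same-class i j i< j< same lt eq with odd (i % r) in parity
      ... | false = <-irrefl (trans (track-index i) (trans eq (sym track-j))) (track-increasing (i % r) parity (i / r) (j / r) lt range-j)
        where
        range-j : InRange (i % r) (j / r)
        range-j = subst (λ z → InRange z (j / r)) (sym same) (index-in-range j j<)
        track-j : track (i % r) (j / r) ≡ ρ (v j)
        track-j = trans (cong (λ z → track z (j / r)) same) (track-index j)
      ... | true = <-irrefl (trans track-j (trans (sym eq) (sym (track-index i)))) (track-decreasing (i % r) parity (i / r) (j / r) lt range-j)
        where
        range-j : InRange (i % r) (j / r)
        range-j = subst (λ z → InRange z (j / r)) (sym same) (index-in-range j j<)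
        track-j : track (i % r) (j / r) ≡ ρ (v j)
        track-j = trans (cong (λ z → track z (j / r)) same) (track-index j)

      distinct : ∀ i j → i < K + r → j < K + r → i ≢ j → v i ≢ v j
      distinct i j i< j< i≢j vi≡vj with <-cmp (i % r) (j % r)
      ... | tri< lt _ _ = <-irrefl (cong ρ vi≡vj) (different-classes i j i< j< lt)
      ... | tri> _ _ gt = <-irrefl (cong ρ (sym vi≡vj)) (different-classes j i j< i< gt)
      ... | tri≈ _ same _ with <-cmp (i / r) (j / r)
      ...   | tri< lt _ _ = same-class i j i< j< same lt (cong ρ vi≡vj)
      ...   | tri> _ _ gt = same-class j i j< i< (sym same) gt (cong ρ (sym vi≡vj))
      ...   | tri≈ _ same' _ = i≢j (trans (decompose i) (trans (cong₂ (λ a b → a + b * r) same same') (sym (decompose j))))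

      segment-hi<n : ∀ J → segment-hi J < n
      segment-hi<n J with odd J
      ... | false = rot<n (v 0) _
      ... | true = rot<n (v 0) _

      below-end : ∀ J q → J + q * r < K + r → InRange J q
      below-end J q lt = s≤s⁻¹ (subst (J + q * r <_) (+-suc K m) lt)

      zigzag : Zigzag n r (suc K) H
      zigzag = record
        { v = v
        ; distinct = distinct
        ; tight = λ i i<k → pointSet (window r v i) , proj₂ (edge i i<k) , λ x →
                    mk⇔ (λ x∈ → Equivalence.to (occurs-window r v i x) (Equivalence.to (∈-pointSet x (window r v i)) x∈))
                        (λ x∈ → Equivalence.from (∈-pointSet x (window r v i)) (Equivalence.from (occurs-window r v i x) x∈))
        ; s = v 0
        ; lo = λ j → segment-lo (toℕ j)
        ; hi = λ j → segment-hi (toℕ j)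
        ; lo≤hi = λ j → segment-nonempty (toℕ j) (toℕ<n j)
        ; ordered = λ j j' lt → segments-ordered (toℕ j) (toℕ j') lt (toℕ<n j')
        ; bounded = λ j → segment-hi<n (toℕ j)
        ; inSeg = λ j q lt → in-segment (toℕ j) (toℕ<n j) q (below-end (toℕ j) q lt)
        ; monotone = λ j q lt → let moves = track-step (toℕ j) q (below-end (toℕ j) (suc q) lt) in
                       (λ 2∣j → proj₁ moves (even⇒¬odd (toℕ j) 2∣j))
                     , (λ 2∤j → proj₂ moves (odd-if-not-even (toℕ j) 2∤j))
        }
        where
        odd-if-not-even : ∀ J → ¬ (2 ∣ J) → odd J ≡ true
        odd-if-not-even J 2∤J with odd J in parity
        ... | true = refl
        ... | false = ⊥-elim (2∤J (¬odd⇒even J parity))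

module ClockwiseTuples where
  open import Data.Nat using (ℕ; zero; suc; _+_; _*_; _∸_; _≤_; _<_; z≤n; s≤s; s≤s⁻¹; _≟_; _<?_)
  open import Data.Nat.Properties
  open import Data.Bool using (Bool; true; false; _∨_)
  open import Data.Bool.Properties using (∨-comm; ∨-assoc)
  import Data.Bool as Bool
  open import Data.Fin using (Fin; toℕ; zero; suc) renaming (_≟_ to _≟F_)
  open import Data.Fin.Properties using (toℕ-injective; toℕ<n)
  open import Data.Fin.Subset using (Subset; ∣_∣)
  open import Data.Vec using (Vec; []; _∷_; _∷ʳ_; head; last; lookup; map)
  open import Data.Vec.Properties using (tabulate-cong; tabulate∘lookup; ≡-dec; map-∘; map-cong; map-id)
  open import Data.List using (List; []; _∷_; length; allFin; _++_; concatMap) renaming (map to mapL)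
  open import Data.List.Properties using (length-map; length-tabulate; length-++)
  open import Data.List.Membership.Propositional using (_∈_)
  open import Data.List.Membership.Propositional.Properties using (∈-map⁻; ∈-map⁺; ∈-++⁺ˡ; ∈-++⁺ʳ; ∈-allFin; ∈-concat⁺′)
  open import Data.List.Membership.DecPropositional using () renaming (_∈?_ to member?)
  open import Data.List.Relation.Unary.Unique.Propositional using (Unique)
  import Data.List.Relation.Unary.Unique.Propositional.Properties as Unique
  open import Data.List.Relation.Unary.Any using (here; there)
  open import Data.Product using (Σ; _×_; _,_; proj₁; proj₂)
  open import Data.Sum using (inj₁; inj₂)
  open import Data.Empty using (⊥-elim)
  open import Data.Unit using (⊤; tt)
  open import Relation.Binary.PropositionalEquality
  open import Relation.Binary using (tri<; tri≈; tri>)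
  open import Relation.Nullary using (yes; no; Dec; does)
  open import Relation.Nullary.Decidable using (_×-dec_)
  open import Function using (_∘_)
  open import Data.Nat.Combinatorics using (_C_; nCk+nC[k+1]≡[n+1]C[k+1])
  open import Defs
  open ClockwiseDistance
  open Sums
  open LocalZigzags

  members : ∀ {N} (p : Subset N) → Vec (Fin N) ∣ p ∣
  members [] = []
  members (true ∷ p) = zero ∷ map suc (members p)
  members (false ∷ p) = map suc (members p)

  Sorted : ∀ {N j} → Vec (Fin N) j → Set
  Sorted [] = ⊤
  Sorted (x ∷ g) = Increasing toℕ (toℕ x) g

  increasing-suc : ∀ {N j} q (g : Vec (Fin N) j) → Increasing toℕ q g → Increasing toℕ (suc q) (map suc g)
  increasing-suc q [] _ = tt
  increasing-suc q (y ∷ g) (q<y , rest) = s≤s q<y , increasing-suc (toℕ y) g rest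

  sorted-suc : ∀ {N j} (g : Vec (Fin N) j) → Sorted g → Sorted (map suc g)
  sorted-suc [] _ = tt
  sorted-suc (x ∷ g) sorted = increasing-suc (toℕ x) g sorted

  members-sorted : ∀ {N} (p : Subset N) → Sorted (members p)
  members-sorted [] = tt
  members-sorted (true ∷ p) = above-zero (members p) (members-sorted p)
    where
    above-zero : ∀ {N j} (g : Vec (Fin N) j) → Sorted g → Increasing toℕ 0 (map suc g)
    above-zero [] _ = tt
    above-zero (x ∷ g) sorted = s≤s z≤n , increasing-suc (toℕ x) g sorted
  members-sorted (false ∷ p) = sorted-suc (members p) (members-sorted p)

  occurs-suc : ∀ {N j} (x : Fin N) (g : Vec (Fin N) j) → occurs (suc x) (map suc g) ≡ occurs x g
  occurs-suc x [] = refl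
  occurs-suc x (y ∷ g) = cong (does (x ≟F y) ∨_) (occurs-suc x g)

  occurs-zero : ∀ {N j} (g : Vec (Fin N) j) → occurs zero (map suc g) ≡ false
  occurs-zero [] = refl
  occurs-zero (y ∷ g) = occurs-zero g

  members-occurs : ∀ {N} (p : Subset N) x → occurs x (members p) ≡ lookup p x
  members-occurs (true ∷ p) zero = refl
  members-occurs (false ∷ p) zero = occurs-zero (members p)
  members-occurs (true ∷ p) (suc x) = trans (occurs-suc x (members p)) (members-occurs p x)
  members-occurs (false ∷ p) (suc x) = trans (occurs-suc x (members p)) (members-occurs p x)

  pointSet-members : ∀ {N} (p : Subset N) → pointSet (members p) ≡ p
  pointSet-members p = trans (tabulate-cong (members-occurs p)) (tabulate∘lookup p)

  -- The entry at position i of a non-empty tuple (the last one if i is too large).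
  entry : ∀ {a} {A : Set a} {j} → Vec A (suc j) → ℕ → A
  entry (x ∷ w) zero = x
  entry (x ∷ []) (suc i) = x
  entry (x ∷ y ∷ w) (suc i) = entry (y ∷ w) i

  entry-snoc : ∀ {a} {A : Set a} {j} (g : Vec A (suc j)) x i → i ≤ j → entry (g ∷ʳ x) i ≡ entry g i
  entry-snoc (y ∷ []) x zero _ = refl
  entry-snoc (y ∷ z ∷ g) x zero _ = refl
  entry-snoc (y ∷ z ∷ g) x (suc i) (s≤s i≤j) = entry-snoc (z ∷ g) x i i≤j

  sorted-entries : ∀ {N j} (w : Vec (Fin N) (suc j)) → Sorted w → ∀ a b → a < b → b ≤ j → toℕ (entry w a) < toℕ (entry w b)
  sorted-entries (x ∷ y ∷ g) (x<y , rest) zero (suc b) _ (s≤s b≤j) = <-≤-trans x<y (head≤ (y ∷ g) rest b b≤j)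
    where
    head≤ : ∀ {j} (w : Vec _ (suc j)) → Sorted w → ∀ b → b ≤ j → toℕ (head w) ≤ toℕ (entry w b)
    head≤ (x ∷ g) _ zero _ = ≤-refl
    head≤ (x ∷ y ∷ g) (x<y , rest) (suc b) (s≤s b≤j) = ≤-trans (<⇒≤ x<y) (head≤ (y ∷ g) rest b b≤j)
  sorted-entries (x ∷ y ∷ g) (_ , rest) (suc a) (suc b) (s≤s a<b) (s≤s b≤j) = sorted-entries (y ∷ g) rest a b a<b b≤j

  sorted-entry-injective : ∀ {N j} (w : Vec (Fin N) (suc j)) → Sorted w → ∀ a b → a ≤ j → b ≤ j → entry w a ≡ entry w b → a ≡ b
  sorted-entry-injective w sorted a b a≤j b≤j e with <-cmp a b
  ... | tri< a<b _ _ = ⊥-elim (<-irrefl (cong toℕ e) (sorted-entries w sorted a b a<b b≤j))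
  ... | tri≈ _ a≡b _ = a≡b
  ... | tri> _ _ b<a = ⊥-elim (<-irrefl (cong toℕ (sym e)) (sorted-entries w sorted b a b<a a≤j))

  absorption : ∀ n k → suc k * (suc n C suc k) ≡ suc n * (n C k)
  absorption zero zero = refl
  absorption zero (suc k) = *-zeroʳ (suc (suc k))
  absorption (suc n) k = begin
    suc k * (suc (suc n) C suc k)                  ≡⟨ cong (suc k *_) (nCk+nC[k+1]≡[n+1]C[k+1] (suc n) k) ⟨
    suc k * (suc n C k + suc n C suc k)            ≡⟨ *-distribˡ-+ (suc k) (suc n C k) (suc n C suc k) ⟩
    suc k * (suc n C k) + suc k * (suc n C suc k)  ≡⟨ cong (suc k * (suc n C k) +_) (absorption n k) ⟩
    suc k * (suc n C k) + suc n * (n C k)          ≡⟨ lower k ⟩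
    suc (suc n) * (suc n C k)                      ∎
    where
    open ≡-Reasoning
    lower : ∀ k → suc k * (suc n C k) + suc n * (n C k) ≡ suc (suc n) * (suc n C k)
    lower zero = refl
    lower (suc k) = begin
      (suc n C suc k + suc k * (suc n C suc k)) + suc n * (n C suc k)  ≡⟨ cong (λ z → (suc n C suc k + z) + suc n * (n C suc k)) (absorption n k) ⟩
      (suc n C suc k + suc n * (n C k)) + suc n * (n C suc k)          ≡⟨ +-assoc (suc n C suc k) _ _ ⟩
      suc n C suc k + (suc n * (n C k) + suc n * (n C suc k))          ≡⟨ cong (suc n C suc k +_) (*-distribˡ-+ (suc n) (n C k) (n C suc k)) ⟨
      suc n C suc k + suc n * (n C k + n C suc k)                      ≡⟨ cong (λ z → suc n C suc k + suc n * z) (nCk+nC[k+1]≡[n+1]C[k+1] n k) ⟩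
      suc n C suc k + suc n * (suc n C suc k)                          ∎

  increasingVectors : (j lo c : ℕ) → List (Vec ℕ j)
  increasingVectors zero lo c = [] ∷ []
  increasingVectors (suc j) lo zero = []
  increasingVectors (suc j) lo (suc c) = mapL (lo ∷_) (increasingVectors j (suc lo) c) ++ increasingVectors (suc j) (suc lo) c

  increasingVectors-length : ∀ j lo c → length (increasingVectors j lo c) ≡ c C j
  increasingVectors-length zero lo c = refl
  increasingVectors-length (suc j) lo zero = refl
  increasingVectors-length (suc j) lo (suc c) =
    trans (length-++ (mapL (lo ∷_) (increasingVectors j (suc lo) c)))
          (trans (cong₂ _+_ (trans (length-map (lo ∷_) (increasingVectors j (suc lo) c)) (increasingVectors-length j (suc lo) c))
                            (increasingVectors-length (suc j) (suc lo) c))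
                 (nCk+nC[k+1]≡[n+1]C[k+1] c j))

  IncreasingIn : ∀ {j} → ℕ → ℕ → Vec ℕ j → Set
  IncreasingIn lo B [] = ⊤
  IncreasingIn lo B (x ∷ h) = lo ≤ x × x < B × IncreasingIn (suc x) B h

  increasingVectors-complete : ∀ j lo c (h : Vec ℕ j) → IncreasingIn lo (lo + c) h → h ∈ increasingVectors j lo c
  increasingVectors-complete zero lo c [] _ = here refl
  increasingVectors-complete (suc j) lo zero (x ∷ h) (lo≤x , x<lo , _) = ⊥-elim (<⇒≱ x<lo (subst (_≤ x) (sym (+-identityʳ lo)) lo≤x))
  increasingVectors-complete (suc j) lo (suc c) (x ∷ h) (lo≤x , x<B , rest) with lo ≟ x
  ... | yes refl = ∈-++⁺ˡ (∈-map⁺ (lo ∷_) (increasingVectors-complete j (suc lo) c h (subst (λ z → IncreasingIn (suc lo) z h) (+-suc lo c) rest)))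
  ... | no lo≢x = ∈-++⁺ʳ (mapL (lo ∷_) (increasingVectors j (suc lo) c))
                   (increasingVectors-complete (suc j) (suc lo) c (x ∷ h)
                     (≤∧≢⇒< lo≤x lo≢x , subst (x <_) (+-suc lo c) x<B , subst (λ z → IncreasingIn (suc x) z h) (+-suc lo c) rest))

  length-concatMap : ∀ {a b} {X : Set a} {Y : Set b} (f : X → List Y) xs → length (concatMap f xs) ≡ Σ-list xs (length ∘ f)
  length-concatMap f [] = refl
  length-concatMap f (x ∷ xs) = trans (length-++ (f x)) (cong (length (f x) +_) (length-concatMap f xs))

  module _ {n : ℕ} where
    open Tuples {n} using (rotate)

    top : ∀ {j} → (Fin n → ℕ) → ℕ → Vec (Fin n) j → ℕ
    top f p [] = p
    top f p (y ∷ g) = top f (f y) g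

    top-last : ∀ {j} f p (y : Fin n) (g : Vec (Fin n) j) → top f p (y ∷ g) ≡ f (last (y ∷ g))
    top-last f p y [] = refl
    top-last f p y (z ∷ g) = top-last f (f y) z g

    increasing-snoc : ∀ {j} f p (g : Vec (Fin n) j) x → Increasing f p g → top f p g < f x → Increasing f p (g ∷ʳ x)
    increasing-snoc f p [] x _ lt = lt , tt
    increasing-snoc f p (y ∷ g) x (p<fy , rest) lt = p<fy , increasing-snoc f (f y) g x rest lt

    increasing-unsnoc : ∀ {j} f p (g : Vec (Fin n) j) x → Increasing f p (g ∷ʳ x) → Increasing f p g × top f p g < f x
    increasing-unsnoc f p [] x (lt , _) = tt , lt
    increasing-unsnoc f p (y ∷ g) x (p<fy , rest) with increasing-unsnoc f (f y) g x rest
    ... | inc , lt = (p<fy , inc) , lt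

    increasing-top : ∀ {j} f p (g : Vec (Fin n) j) → Increasing f p g → p ≤ top f p g
    increasing-top f p [] _ = ≤-refl
    increasing-top f p (y ∷ g) (p<fy , rest) = ≤-trans (<⇒≤ p<fy) (increasing-top f (f y) g rest)

    top<n : ∀ {j} a p (g : Vec (Fin n) j) → p < n → top (rot a) p g < n
    top<n a p [] p<n = p<n
    top<n a p (y ∷ g) _ = top<n a (rot a y) g (rot<n a y)

    rebase-forward : ∀ {j} x y p (g : Vec (Fin n) j) → Increasing (rot x) p g → rot x y ≤ p →
                     Increasing (rot y) (p ∸ rot x y) g × top (rot y) (p ∸ rot x y) g ≡ top (rot x) p g ∸ rot x y
    rebase-forward x y p [] _ _ = tt , refl
    rebase-forward x y p (z ∷ g) (p<xz , rest) xy≤p =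
      (subst (p ∸ rot x y <_) via (∸-monoˡ-< p<xz xy≤p) , subst (λ q → Increasing (rot y) q g) via (proj₁ rec))
      , trans (cong (λ q → top (rot y) q g) (sym via)) (proj₂ rec)
      where
      xy≤xz : rot x y ≤ rot x z
      xy≤xz = ≤-trans xy≤p (<⇒≤ p<xz)
      via : rot x z ∸ rot x y ≡ rot y z
      via = trans (cong (_∸ rot x y) (sym (rot-via x y z xy≤xz))) (m+n∸m≡n (rot x y) (rot y z))
      rec : Increasing (rot y) (rot x z ∸ rot x y) g × top (rot y) (rot x z ∸ rot x y) g ≡ top (rot x) (rot x z) g ∸ rot x y
      rec = rebase-forward x y (rot x z) g rest xy≤xz

    rebase-backward : ∀ {j} x y p (g : Vec (Fin n) j) → Increasing (rot y) p g → top (rot y) p g < rot y x → x ≢ y →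
                      Increasing (rot x) (rot x y + p) g
    rebase-backward x y p [] _ _ _ = tt
    rebase-backward x y p (z ∷ g) (p<yz , rest) top<yx x≢y =
      subst (rot x y + p <_) (sym via) (+-monoʳ-< (rot x y) p<yz)
      , subst (λ q → Increasing (rot x) q g) (sym via) (rebase-backward x y (rot y z) g rest top<yx x≢y)
      where
      yz<yx : rot y z < rot y x
      yz<yx = ≤-<-trans (increasing-top (rot y) (rot y z) g rest) top<yx
      via : rot x z ≡ rot x y + rot y z
      via with rot-add x y z
      ... | inj₁ e = sym e
      ... | inj₂ e = ⊥-elim (<⇒≱ (+-monoʳ-< (rot x y) yz<yx)
                       (≤-trans (≤-reflexive (rot-there-and-back x y x≢y)) (≤-trans (m≤n+m n (rot x z)) (≤-reflexive (sym e)))))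

    clockwise-rotate : ∀ {j} (x : Fin n) (g : Vec (Fin n) j) → Clockwise (x ∷ g) → Clockwise (g ∷ʳ x)
    clockwise-rotate x [] _ = tt
    clockwise-rotate x (y ∷ g) (xy>0 , rest) = increasing-snoc (rot y) 0 g x from-y top<yx
      where
      a : ℕ
      a = rot x y
      rebased : Increasing (rot y) (a ∸ a) g × top (rot y) (a ∸ a) g ≡ top (rot x) a g ∸ a
      rebased = rebase-forward x y a g rest ≤-refl
      from-y : Increasing (rot y) 0 g
      from-y = subst (λ q → Increasing (rot y) q g) (n∸n≡0 a) (proj₁ rebased)
      x≢y : x ≢ y
      x≢y e = <-irrefl (sym (trans (cong (rot x) (sym e)) (rot-self x))) xy>0
      top<yx : top (rot y) 0 g < rot y x
      top<yx = subst (_< rot y x) (trans (sym (proj₂ rebased)) (cong (λ q → top (rot y) q g) (n∸n≡0 a)))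
                 (subst (top (rot x) a g ∸ a <_) (trans (cong (_∸ a) (sym (rot-there-and-back x y x≢y))) (m+n∸m≡n a (rot y x)))
                   (∸-monoˡ-< (top<n x a g (rot<n x y)) (increasing-top (rot x) a g rest)))

    clockwise-unrotate : ∀ {j} (x : Fin n) (g : Vec (Fin n) j) → Clockwise (g ∷ʳ x) → Clockwise (x ∷ g)
    clockwise-unrotate x [] _ = tt
    clockwise-unrotate x (y ∷ g) c with increasing-unsnoc (rot y) 0 g x c
    ... | inc , top<yx = rot-pos x y x≢y , subst (λ q → Increasing (rot x) q g) (+-identityʳ (rot x y)) (rebase-backward x y 0 g inc top<yx x≢y)
      where
      x≢y : x ≢ y
      x≢y e = <-irrefl (sym (trans (cong (rot y) e) (rot-self y))) (≤-<-trans z≤n top<yx)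

    occurs-snoc : ∀ {j} z (g : Vec (Fin n) j) x → occurs z (g ∷ʳ x) ≡ occurs z g ∨ does (z ≟F x)
    occurs-snoc z [] x = ∨-comm (does (z ≟F x)) false
    occurs-snoc z (y ∷ g) x = trans (cong (does (z ≟F y) ∨_) (occurs-snoc z g x)) (sym (∨-assoc (does (z ≟F y)) (occurs z g) _))

    pointSet-rotate : ∀ {j} (x : Fin n) (g : Vec (Fin n) j) → pointSet (g ∷ʳ x) ≡ pointSet (x ∷ g)
    pointSet-rotate x g = tabulate-cong (λ z → trans (occurs-snoc z g x) (∨-comm (occurs z g) (does (z ≟F x))))

    increasing? : ∀ {j} f p (g : Vec (Fin n) j) → Dec (Increasing f p g)
    increasing? f p [] = yes tt
    increasing? f p (y ∷ g) = (p <? f y) ×-dec increasing? f (f y) g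

    clockwise? : ∀ {j} (g : Vec (Fin n) j) → Dec (Clockwise g)
    clockwise? [] = yes tt
    clockwise? (a ∷ g) = increasing? (rot a) 0 g

    _≟S_ : (s e : Subset n) → Dec (s ≡ e)
    _≟S_ = ≡-dec Bool._≟_

    rot-forward : ∀ (x y : Fin n) → toℕ x ≤ toℕ y → rot x y ≡ toℕ y ∸ toℕ x
    rot-forward x y x≤y = rot-unique x y _ (≤-<-trans (m∸n≤m (toℕ y) (toℕ x)) (toℕ<n y)) (inj₁ (m∸n+n≡m x≤y))

    sorted-increasing : ∀ {j} x q (g : Vec (Fin n) j) → Increasing toℕ q g → toℕ x ≤ q → Increasing (rot x) (q ∸ toℕ x) g
    sorted-increasing x q [] _ _ = tt
    sorted-increasing x q (y ∷ g) (q<y , rest) x≤q =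
      subst (q ∸ toℕ x <_) (sym (rot-forward x y x≤y)) (∸-monoˡ-< q<y x≤q)
      , subst (λ z → Increasing (rot x) z g) (sym (rot-forward x y x≤y)) (sorted-increasing x (toℕ y) g rest x≤y)
      where
      x≤y : toℕ x ≤ toℕ y
      x≤y = ≤-trans x≤q (<⇒≤ q<y)

    sorted-clockwise : ∀ {j} (w : Vec (Fin n) j) → Sorted w → Clockwise w
    sorted-clockwise [] _ = tt
    sorted-clockwise (x ∷ g) sorted = subst (λ z → Increasing (rot x) z g) (n∸n≡0 (toℕ x)) (sorted-increasing x (toℕ x) g sorted ≤-refl)

    rotations : ∀ {j} → ℕ → Vec (Fin n) (suc j) → Vec (Fin n) (suc j)
    rotations zero u = u
    rotations (suc t) u = rotate (rotations t u)

    entry-rotations : ∀ {j} (w : Vec (Fin n) (suc j)) t i → t + i ≤ j → entry (rotations t w) i ≡ entry w (t + i)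
    entry-rotations w zero i _ = refl
    entry-rotations {j} w (suc t) i t+i<j =
      trans (entry-rotate (rotations t w) i (≤-trans (s≤s (m≤n+m i t)) t+i<j))
            (trans (entry-rotations w t (suc i) (subst (_≤ j) (sym (+-suc t i)) t+i<j)) (cong (entry w) (+-suc t i)))
      where
      entry-rotate : ∀ {j} (w : Vec (Fin n) (suc j)) i → suc i ≤ j → entry (rotate w) i ≡ entry w (suc i)
      entry-rotate (x ∷ y ∷ g) i i<j = entry-snoc (y ∷ g) x i (s≤s⁻¹ i<j)

    clockwise-rotations : ∀ {j} t (u : Vec (Fin n) (suc j)) → Clockwise u → Clockwise (rotations t u)
    clockwise-rotations zero u c = c
    clockwise-rotations (suc t) u c with rotations t u | clockwise-rotations t u c
    ... | x ∷ g | c' = clockwise-rotate x g c'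

    pointSet-rotations : ∀ {j} t (u : Vec (Fin n) (suc j)) → pointSet (rotations t u) ≡ pointSet u
    pointSet-rotations zero u = refl
    pointSet-rotations (suc t) u with rotations t u | pointSet-rotations t u
    ... | x ∷ g | e = trans (pointSet-rotate x g) e

    orientations : ∀ {j} → Vec (Fin n) (suc j) → List (Vec (Fin n) (suc j))
    orientations {j} u = mapL (λ t → rotations (toℕ t) u) (allFin (suc j))

    orientations-spec : ∀ j (u : Vec (Fin n) (suc j)) → Sorted u →
      Unique (orientations u) × length (orientations u) ≡ suc j × (∀ w → w ∈ orientations u → Clockwise w × pointSet w ≡ pointSet u)
    orientations-spec j u sorted = Unique.map⁺ distinct (Unique.allFin⁺ (suc j))
                                 , trans (length-map _ (allFin (suc j))) (length-tabulate (λ z → z))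
                                 , members-ok
      where
      head-rotations : ∀ (t : Fin (suc j)) → head (rotations (toℕ t) u) ≡ entry u (toℕ t)
      head-rotations t with rotations (toℕ t) u in e
      ... | x ∷ _ = trans (cong (λ w → entry w 0) (sym e))
                      (trans (entry-rotations u (toℕ t) 0 (subst (_≤ j) (sym (+-identityʳ (toℕ t))) (s≤s⁻¹ (toℕ<n t))))
                             (cong (entry u) (+-identityʳ (toℕ t))))
      distinct : ∀ {t t'} → rotations (toℕ t) u ≡ rotations (toℕ t') u → t ≡ t'
      distinct {t} {t'} e = toℕ-injective (sorted-entry-injective u sorted (toℕ t) (toℕ t') (s≤s⁻¹ (toℕ<n t)) (s≤s⁻¹ (toℕ<n t'))
                              (trans (sym (head-rotations t)) (trans (cong head e) (head-rotations t'))))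
      members-ok : ∀ w → w ∈ orientations u → Clockwise w × pointSet w ≡ pointSet u
      members-ok w w∈ with ∈-map⁻ (λ t → rotations (toℕ t) u) {xs = allFin (suc j)} w∈
      ... | t , _ , refl = clockwise-rotations (toℕ t) u (sorted-clockwise u sorted) , pointSet-rotations (toℕ t) u

    clockwise-head>0 : ∀ {j} z (g : Vec (Fin n) (suc j)) → Clockwise (z ∷ g) → 0 < rot z (head g)
    clockwise-head>0 z (y ∷ g') (z<y , _) = z<y

    clockwise-head≤last : ∀ {j} z (g : Vec (Fin n) (suc j)) → Clockwise (z ∷ g) → rot z (head g) ≤ rot z (last g)
    clockwise-head≤last z (y ∷ g') (_ , rest) = subst (rot z y ≤_) (top-last (rot z) 0 y g') (increasing-top (rot z) (rot z y) g' rest)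

    clockwise-first≢last : ∀ {j} z (g : Vec (Fin n) (suc j)) → Clockwise (z ∷ g) → z ≢ last g
    clockwise-first≢last z g c e =
      <-irrefl (sym (trans (cong (rot z) (sym e)) (rot-self z))) (<-≤-trans (clockwise-head>0 z g c) (clockwise-head≤last z g c))

    clockwise-tail : ∀ {j} x (g : Vec (Fin n) (suc j)) → Clockwise (x ∷ g) → Clockwise g
    clockwise-tail x (y ∷ g') c = proj₁ (increasing-unsnoc (rot y) 0 g' x (clockwise-rotate x (y ∷ g') c))

    between-first-and-head : ∀ {j} x y (g : Vec (Fin n) (suc j)) → Clockwise (x ∷ g) → Clockwise (y ∷ g) →
                             rot (last g) x < rot (last g) y → Between x y (head g)
    between-first-and-head x y g cx cy lt = x<y , y<head
      where
      a hd : Fin n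
      a = last g
      hd = head g
      via : rot a x + rot x y ≡ rot a y
      via = rot-via a x y (<⇒≤ lt)
      x<y : 0 < rot x y
      x<y with rot x y in eq
      ... | zero = ⊥-elim (<-irrefl (trans (sym (+-identityʳ (rot a x))) (trans (cong (rot a x +_) (sym eq)) via)) lt)
      ... | suc _ = s≤s z≤n
      a≢x : a ≢ x
      a≢x e = clockwise-first≢last x g cx (sym e)
      y<head : rot x y < rot x hd
      y<head with hd ≟F a
      ... | yes hd≡a = subst (λ z → rot x y < rot x z) (sym hd≡a)
                         (+-cancelˡ-< (rot a x) _ _ (subst₂ _<_ (sym via) (sym (rot-there-and-back a x a≢x)) (rot<n a y)))
      ... | no hd≢a = +-cancelˡ-< (rot a x) _ _ (subst₂ _<_ (sym via) (sym (rot-via a x hd (<⇒≤ (<-trans lt ay<ahd)))) ay<ahd)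
        where
        y≢hd : y ≢ hd
        y≢hd e = <-irrefl (sym (trans (cong (rot y) (sym e)) (rot-self y))) (clockwise-head>0 y g cy)
        hd<a : rot y hd < rot y a
        hd<a = ≤∧≢⇒< (clockwise-head≤last y g cy) (λ e → hd≢a (rot-inj y hd a e))
        ay<ahd : rot a y < rot a hd
        ay<ahd = rot-cycle hd a y hd≢a (rot-cycle y hd a y≢hd hd<a)

    between-last-and-first : ∀ {j} x y (g : Vec (Fin n) (suc j)) → Clockwise (y ∷ g) → rot (last g) y < rot (last g) x → Between (last g) y x
    between-last-and-first x y g cy lt = rot-pos (last g) y (λ e → clockwise-first≢last y g cy (sym e)) , lt

  module _ (n m' : ℕ) (H : CGH n (suc (suc m'))) where
    open Local n m' H
    open Tuples {n} using (rotate)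

    oriented-rotate : ∀ (w : Vec (Fin n) r) → OrientedEdge w → OrientedEdge (rotate w)
    oriented-rotate (x ∷ g) (c , e) = clockwise-rotate x g c , subst (_∈ edges H) (sym (pointSet-rotate x g)) e

    oriented-unrotate : ∀ (w : Vec (Fin n) r) → OrientedEdge (rotate w) → OrientedEdge w
    oriented-unrotate (x ∷ g) (c , e) = clockwise-unrotate x g c , subst (_∈ edges H) (pointSet-rotate x g) e

    oriented? : ∀ (w : Vec (Fin n) r) → Dec (OrientedEdge w)
    oriented? w = clockwise? w ×-dec member? _≟S_ (pointSet w) (edges H)

    edge-orientations : ∀ (e : Subset n) → ∣ e ∣ ≡ r →
      Σ (List (Vec (Fin n) r)) λ L → Unique L × length L ≡ r × (∀ w → w ∈ L → Clockwise w × pointSet w ≡ e)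
    edge-orientations e size = from-members ∣ e ∣ (members e) (members-sorted e) (pointSet-members e) size
      where
      from-members : ∀ J (u : Vec (Fin n) J) → Sorted u → pointSet u ≡ e → J ≡ r →
        Σ (List (Vec (Fin n) r)) λ L → Unique L × length L ≡ r × (∀ w → w ∈ L → Clockwise w × pointSet w ≡ e)
      from-members .r u sorted u-e refl with orientations-spec m u sorted
      ... | unique , len , ok = orientations u , unique , len , λ w w∈ → proj₁ (ok w w∈) , trans (proj₂ (ok w w∈)) u-e

    open Tuples using (Σ-tuples; Σ-tuples-mono; Σ-tuples-Σ-list; length≤count)

    edges≤oriented : r * length (edges H) ≤ Σ-tuples r (λ w → 𝟙 (oriented? w))
    edges≤oriented = begin
      r * length (edges H)                                  ≡⟨ Σ-list-const r (edges H) ⟨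
      Σ-list (edges H) (λ _ → r)                            ≤⟨ Σ-list-mono (edges H) (uniform H) orientations-of ⟩
      Σ-list (edges H) (λ e → Σ-tuples r (λ w → 𝟙 (is w e))) ≡⟨ Σ-tuples-Σ-list r (edges H) (λ w e → 𝟙 (is w e)) ⟨
      Σ-tuples r (λ w → Σ-list (edges H) (λ e → 𝟙 (is w e))) ≤⟨ Σ-tuples-mono r at-most-once ⟩
      Σ-tuples r (λ w → 𝟙 (oriented? w))                     ∎
      where
      open ≤-Reasoning
      is : ∀ w e → Dec (Clockwise w × pointSet w ≡ e)
      is w e = clockwise? w ×-dec (pointSet w ≟S e)
      orientations-of : ∀ e → ∣ e ∣ ≡ r → r ≤ Σ-tuples r (λ w → 𝟙 (is w e))
      orientations-of e size with edge-orientations e size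
      ... | L , unique , len , ok = subst (_≤ _) len (length≤count r (λ w → is w e) L unique ok)
      at-most-once : ∀ w → Σ-list (edges H) (λ e → 𝟙 (is w e)) ≤ 𝟙 (oriented? w)
      at-most-once w = by-cases (clockwise? w)
        where
        as-pointSet : ∀ c → Σ-list (edges H) (λ e → 𝟙 (yes c ×-dec (pointSet w ≟S e))) ≡ Σ-list (edges H) (λ e → 𝟙 (pointSet w ≟S e))
        as-pointSet c = Σ-list-cong (edges H) (λ e → 𝟙-cong (yes c ×-dec (pointSet w ≟S e)) (pointSet w ≟S e) proj₂ (c ,_))
        by-cases : (c? : Dec (Clockwise w)) → Σ-list (edges H) (λ e → 𝟙 (c? ×-dec (pointSet w ≟S e))) ≤ 𝟙 (oriented? w)
        by-cases (no ¬c) = ≤-trans (≤-reflexive (none (edges H))) z≤n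
          where
          none : ∀ L → Σ-list L (λ e → 𝟙 (no ¬c ×-dec (pointSet w ≟S e))) ≡ 0
          none [] = refl
          none (_ ∷ L) = none L
        by-cases (yes c) with Σ-list-unique _≟S_ (pointSet w) (edges H) (unique H)
        ... | _ , inj₁ none = ≤-trans (≤-reflexive (trans (as-pointSet c) none)) z≤n
        ... | once , inj₂ w∈H = ≤-trans (≤-reflexive (as-pointSet c)) (≤-trans once (≤-reflexive (sym (𝟙-yes (oriented? w) (c , w∈H)))))

  -- The number of clockwise m-tuples on Ω_n (n = n' + 1, m = m' + 1): a
  -- clockwise tuple is its head a followed by points at increasing clockwise
  -- distances in [1, n) from a.
  module CountClockwise (n' m' : ℕ) where
    n m : ℕ
    n = suc n'
    m = suc m'
    open Tuples {n} using (Σ-tuples; count≤length)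

    -- The point at distance d from a (a itself if d is out of range).
    at : Fin n → ℕ → Fin n
    at a d with d <? n
    ... | yes d<n = shift a d d<n
    ... | no _ = a

    at-rot : ∀ a x → at a (rot a x) ≡ x
    at-rot a x with rot a x <? n
    ... | yes d<n = rot-inj a _ _ (rot-shift a (rot a x) d<n)
    ... | no d≮n = ⊥-elim (d≮n (rot<n a x))

    fromDistances : Fin n → Vec ℕ m' → Vec (Fin n) m
    fromDistances a h = a ∷ map (at a) h

    clockwiseTuples : List (Vec (Fin n) m)
    clockwiseTuples = concatMap (λ a → mapL (fromDistances a) (increasingVectors m' 1 n')) (allFin n)

    clockwiseTuples-length : length clockwiseTuples ≡ m * (n C m)
    clockwiseTuples-length = begin
      length clockwiseTuples                           ≡⟨ length-concatMap (λ a → mapL (fromDistances a) vectors) (allFin n) ⟩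
      Σ-list (allFin n) (λ a → length (mapL (fromDistances a) vectors))
                                                       ≡⟨ Σ-list-cong (allFin n) (λ a → trans (length-map (fromDistances a) vectors) (increasingVectors-length m' 1 n')) ⟩
      Σ-list (allFin n) (λ _ → n' C m')                ≡⟨ Σ-list-const (n' C m') (allFin n) ⟩
      (n' C m') * length (allFin n)                    ≡⟨ cong ((n' C m') *_) (length-tabulate {n = n} (λ z → z)) ⟩
      (n' C m') * n                                    ≡⟨ *-comm (n' C m') n ⟩
      n * (n' C m')                                    ≡⟨ absorption n' m' ⟨
      m * (n C m)                                      ∎
      where
      open ≡-Reasoning
      vectors : List (Vec ℕ m')
      vectors = increasingVectors m' 1 n'

    clockwiseTuples-complete : ∀ g → Clockwise g → g ∈ clockwiseTuples
    clockwiseTuples-complete (a ∷ g) c = ∈-concat⁺′ (subst (_∈ mapL (fromDistances a) (increasingVectors m' 1 n')) back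
                                                         (∈-map⁺ _ (increasingVectors-complete m' 1 n' (map (rot a) g) distances)))
                                                  (∈-map⁺ _ (∈-allFin a))
      where
      as-distances : ∀ {j} p (g : Vec (Fin n) j) → Increasing (rot a) p g → IncreasingIn (suc p) n (map (rot a) g)
      as-distances p [] _ = tt
      as-distances p (y ∷ g) (p<y , rest) = p<y , rot<n a y , as-distances (rot a y) g rest
      distances : IncreasingIn 1 (1 + n') (map (rot a) g)
      distances = as-distances 0 g c
      back : a ∷ map (at a) (map (rot a) g) ≡ a ∷ g
      back = cong (a ∷_) (trans (sym (map-∘ (at a) (rot a) g)) (trans (map-cong (at-rot a) g) (map-id g)))

    clockwise≤ : Tuples.Σ-tuples m (λ g → 𝟙 (clockwise? g)) ≤ m * (n C m)
    clockwise≤ = ≤-trans (count≤length m clockwise? clockwiseTuples clockwiseTuples-complete) (≤-reflexive clockwiseTuples-length)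

module Telescoping where
  open import Data.Nat using (ℕ; zero; suc; _+_; _*_; _∸_; _≤_; _<_; z≤n; s≤s⁻¹; _<?_; _≟_)
  open import Data.Nat.Properties
  open import Data.Fin using (Fin) renaming (_≟_ to _≟F_)
  open import Data.Fin.Properties using (any?)
  open import Data.Product using (_×_; _,_; proj₁)
  open import Relation.Binary.PropositionalEquality
  open import Relation.Nullary using (yes; no; Dec)
  open import Relation.Nullary.Decidable using (_×-dec_)
  open Sums
  open import Data.Nat.Solver using (module +-*-Solver)
  open +-*-Solver using (solve; _:+_; _:=_)

  -- Order the candidates x (those satisfying C) by
  -- an injective key d.  If a x < b y whenever x precedes y, then summing
  -- a x + 1 ≤ b (next x) over consecutive candidates, and bounding the last one
  -- by U + δ ≤ U + b (first candidate), gives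
  --     Σ_{C x} (1 + a x) ≤ U + Σ_{C x} b x.
  module _ {n : ℕ} (C : Fin n → Set) (C? : ∀ x → Dec (C x)) (a b d : Fin n → ℕ) (δ : ℕ)
           (δ≤b : ∀ x → C x → δ ≤ b x)
           (a<b : ∀ x y → C x → C y → d x < d y → a x < b y)
           (d-injective : ∀ x y → C x → C y → d x ≡ d y → x ≡ y) where

    Below : ℕ → Fin n → Set
    Below T x = C x × d x < T

    Below? : ∀ T x → Dec (Below T x)
    Below? T x = C? x ×-dec (d x <? T)

    add-candidate : ∀ T x₀ → C x₀ → d x₀ ≡ T → ∀ (F : Fin n → ℕ) →
                    sum (λ x → 𝟙 (Below? (suc T) x) * F x) ≡ sum (λ x → 𝟙 (Below? T x) * F x) + F x₀
    add-candidate T x₀ cx₀ dx₀ F =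
      trans (sum-cong-≗ (λ x → trans (cong (_* F x) (split x)) (*-distribʳ-+ (F x) (𝟙 (Below? T x)) (𝟙 (x ≟F x₀)))))
            (trans (∑-distrib-+ (λ x → 𝟙 (Below? T x) * F x) (λ x → 𝟙 (x ≟F x₀) * F x))
                   (cong (sum (λ x → 𝟙 (Below? T x) * F x) +_) (sum-point x₀ F)))
      where
      split : ∀ x → 𝟙 (Below? (suc T) x) ≡ 𝟙 (Below? T x) + 𝟙 (x ≟F x₀)
      split x with x ≟F x₀
      ... | yes refl = trans (𝟙-yes (Below? (suc T) x₀) (cx₀ , subst (_< suc T) (sym dx₀) ≤-refl))
                             (cong (_+ 1) (sym (𝟙-no (Below? T x₀) (λ (_ , lt) → <-irrefl dx₀ lt))))
      ... | no x≢x₀ = trans (𝟙-cong (Below? (suc T) x) (Below? T x)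
                              (λ (c , lt) → c , ≤∧≢⇒< (s≤s⁻¹ lt) (λ e → x≢x₀ (d-injective x x₀ c cx₀ (trans e (sym dx₀)))))
                              (λ (c , lt) → c , ≤-trans lt (n≤1+n T)))
                            (sym (+-identityʳ _))

    no-candidate : ∀ T → (∀ x → C x → d x ≢ T) → ∀ x → 𝟙 (Below? (suc T) x) ≡ 𝟙 (Below? T x)
    no-candidate T none x = 𝟙-cong (Below? (suc T) x) (Below? T x)
                              (λ (c , lt) → c , ≤∧≢⇒< (s≤s⁻¹ lt) (none x c))
                              (λ (c , lt) → c , ≤-trans lt (n≤1+n T))

    -- The inequality restricted to candidates below T, by induction on T: the
    -- candidate x₀ with key T (if any) is handled by the bound U + δ, and the
    -- earlier ones by induction with U replaced by b x₀ - δ.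
    telescope-below : ∀ T U → (∀ x → Below T x → a x + 1 ≤ U + δ) →
                      sum (λ x → 𝟙 (Below? T x) * (1 + a x)) ≤ U + sum (λ x → 𝟙 (Below? T x) * b x)
    telescope-below zero U _ = ≤-trans (≤-reflexive (sum-zero (λ x → cong (_* (1 + a x)) (𝟙-no (Below? 0 x) λ ())))) z≤n
    telescope-below (suc T) U last≤ with any? (λ x → C? x ×-dec (d x ≟ T))
    ... | no none = begin
      sum (λ x → 𝟙 (Below? (suc T) x) * (1 + a x)) ≡⟨ sum-cong-≗ (λ x → cong (_* (1 + a x)) (no-candidate T none′ x)) ⟩
      sum (λ x → 𝟙 (Below? T x) * (1 + a x))       ≤⟨ telescope-below T U (λ x (c , lt) → last≤ x (c , ≤-trans lt (n≤1+n T))) ⟩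
      U + sum (λ x → 𝟙 (Below? T x) * b x)         ≡⟨ cong (U +_) (sum-cong-≗ (λ x → cong (_* b x) (no-candidate T none′ x))) ⟨
      U + sum (λ x → 𝟙 (Below? (suc T) x) * b x)   ∎
      where
      open ≤-Reasoning
      none′ : ∀ x → C x → d x ≢ T
      none′ x c e = none (x , c , e)
    ... | yes (x₀ , cx₀ , dx₀) = begin
      sum (λ x → 𝟙 (Below? (suc T) x) * (1 + a x))  ≡⟨ add-candidate T x₀ cx₀ dx₀ (λ x → 1 + a x) ⟩
      sum (λ x → 𝟙 (Below? T x) * (1 + a x)) + (1 + a x₀)
        ≤⟨ +-mono-≤ (telescope-below T (b x₀ ∸ δ) before-x₀) (≤-trans (≤-reflexive (+-comm 1 (a x₀))) (last≤ x₀ (cx₀ , subst (_< suc T) (sym dx₀) ≤-refl))) ⟩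
      (b x₀ ∸ δ + Σb) + (U + δ)                      ≡⟨ regroup (b x₀ ∸ δ) Σb U δ ⟩
      U + (Σb + (b x₀ ∸ δ + δ))                      ≡⟨ cong (λ z → U + (Σb + z)) (m∸n+n≡m (δ≤b x₀ cx₀)) ⟩
      U + (Σb + b x₀)                                ≡⟨ cong (U +_) (add-candidate T x₀ cx₀ dx₀ b) ⟨
      U + sum (λ x → 𝟙 (Below? (suc T) x) * b x)     ∎
      where
      open ≤-Reasoning
      Σb : ℕ
      Σb = sum (λ x → 𝟙 (Below? T x) * b x)
      -- candidates before x₀ telescope into b x₀
      before-x₀ : ∀ x → Below T x → a x + 1 ≤ (b x₀ ∸ δ) + δ
      before-x₀ x (c , lt) = subst (a x + 1 ≤_) (sym (m∸n+n≡m (δ≤b x₀ cx₀)))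
                               (subst (_≤ b x₀) (+-comm 1 (a x)) (a<b x x₀ c cx₀ (subst (d x <_) (sym dx₀) lt)))
      regroup : ∀ p B u e → (p + B) + (u + e) ≡ u + (B + (p + e))
      regroup = solve 4 (λ p B u e → (p :+ B) :+ (u :+ e) := u :+ (B :+ (p :+ e))) refl

    telescope : ∀ T U → (∀ x → d x < T) → (∀ x → C x → a x + 1 ≤ U + δ) →
                sum (λ x → 𝟙 (C? x) * (1 + a x)) ≤ U + sum (λ x → 𝟙 (C? x) * b x)
    telescope T U d<T last≤ = subst₂ _≤_ (all-below (λ x → 1 + a x)) (cong (U +_) (all-below b))
                                (telescope-below T U (λ x (c , _) → last≤ x c))
      where
      all-below : ∀ (F : Fin n → ℕ) → sum (λ x → 𝟙 (Below? T x) * F x) ≡ sum (λ x → 𝟙 (C? x) * F x)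
      all-below F = sum-cong-≗ (λ x → cong (_* F x) (𝟙-cong (Below? T x) (C? x) proj₁ (λ c → c , d<T x)))

module Counting where
  open import Data.Nat using (ℕ; zero; suc; _+_; _*_; _∸_; _≤_; _<_; z≤n; s≤s; s≤s⁻¹; _≤?_; _<?_; _≟_)
  open import Data.Nat.Properties
  open import Data.Nat.Divisibility using (_∣_)
  open import Data.Nat.Combinatorics using (_C_)
  open import Data.Bool using (Bool; true; false; not; if_then_else_)
  open import Data.Fin using (Fin)
  open import Data.Vec using (Vec; []; _∷_; _∷ʳ_; last)
  open import Data.List using (length)
  open import Data.Product using (Σ; _×_; _,_; proj₁)
  open import Data.Sum using (_⊎_; inj₁; inj₂)
  open import Data.Empty using (⊥-elim)
  open import Relation.Binary.PropositionalEquality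
  open import Relation.Nullary using (yes; no; ¬_; Dec)
  open import Defs
  open ClockwiseDistance
  open Residues using (odd; odd⇒positive)
  open Sums
  open LocalZigzags
  open LocalToGlobal
  open ClockwiseTuples
  open Telescoping
  open import Algebra.Properties.CommutativeSemigroup +-commutativeSemigroup using (interchange)

  module _ (n' m' K : ℕ) (H : CGH (suc n') (suc (suc m'))) (2∣r : 2 ∣ suc (suc m'))
           (no-zigzag : ¬ Zigzag (suc n') (suc (suc m')) (suc K) H) where
    n : ℕ
    n = suc n'
    open Local n m' H
    open Tuples {n}

    truncate : ∀ {v ℓ ℓ'} → ℓ' ≤ ℓ → LocalZigzag v ℓ → LocalZigzag v ℓ'
    truncate ℓ'≤ℓ zz = record { edge = λ i lt → edge i (≤-trans lt ℓ'≤ℓ) ; step = λ i lt → step i (≤-trans lt ℓ'≤ℓ) }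
      where open LocalZigzag zz

    chain-bound : ∀ l w p → Chain l w p → l ≤ K
    chain-bound (suc l) w p (v , zz , _ , _) with suc l ≤? K
    ... | yes l+1≤K = l+1≤K
    ... | no l+1≰K = ⊥-elim (no-zigzag (FromLocal.zigzag n m' K H 2∣r v (truncate (≰⇒> l+1≰K) zz)))

    window-entries : ∀ j (w : Vec (Fin n) (suc j)) → window (suc j) (entry w) 0 ≡ w
    window-entries zero (x ∷ []) = refl
    window-entries (suc j) (x ∷ y ∷ g) = cong (x ∷_) (trans (shift-window (suc j) (entry (x ∷ y ∷ g)) 0) (window-entries j (y ∷ g)))
      where
      shift-window : ∀ j (v : ℕ → Fin n) i → window j v (suc i) ≡ window j (λ t → v (suc t)) i
      shift-window zero v i = refl
      shift-window (suc j) v i = cong (v (suc i) ∷_) (shift-window j v (suc i))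

    single-chain : ∀ w → OrientedEdge w → Chain 1 w false
    single-chain w oriented = entry w , record { edge = edge₀ ; step = λ { i (s≤s ()) } } , window-entries m w , refl
      where
      edge₀ : ∀ i → i < 1 → OrientedEdge (window r (entry w) i)
      edge₀ zero _ = subst OrientedEdge (sym (window-entries m w)) oriented
      edge₀ (suc i) (s≤s ())

    -- The rest of the argument needs to decide, for l ≤ K, whether a chain of
    -- length l ends in a given window.
    module Longest (chain?≤K : ∀ l → l < suc K → ∀ w p → Dec (Chain l w p)) where

      chain? : ∀ l w p → Dec (Chain l w p)
      chain? l w p with l <? suc K
      ... | yes l≤K = chain?≤K l l≤K w p
      ... | no l≰K = no (λ c → l≰K (s≤s (chain-bound l w p c)))

      search : ℕ → Vec (Fin n) r → Bool → ℕ
      search zero w p = 0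
      search (suc t) w p with chain? (suc t) w p
      ... | yes _ = suc t
      ... | no _ = search t w p

      search-max : ∀ t w p l → Chain l w p → l ≤ t → l ≤ search t w p
      search-max zero w p (suc l) c ()
      search-max (suc t) w p l c l≤t+1 with chain? (suc t) w p
      ... | yes _ = l≤t+1
      ... | no ¬c with l ≟ suc t
      ...   | yes refl = ⊥-elim (¬c c)
      ...   | no l≢t+1 = search-max t w p l c (s≤s⁻¹ (≤∧≢⇒< l≤t+1 l≢t+1))

      search-chain : ∀ t w p → search t w p ≡ 0 ⊎ Chain (search t w p) w p
      search-chain zero w p = inj₁ refl
      search-chain (suc t) w p with chain? (suc t) w p
      ... | yes c = inj₂ c
      ... | no _ = search-chain t w p

      search≤ : ∀ t w p → search t w p ≤ t
      search≤ zero w p = z≤n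
      search≤ (suc t) w p with chain? (suc t) w p
      ... | yes _ = ≤-refl
      ... | no _ = ≤-trans (search≤ t w p) (n≤1+n t)

      longest : Vec (Fin n) r → Bool → ℕ
      longest w p = search K w p

      longest-max : ∀ w p l → Chain l w p → l ≤ longest w p
      longest-max w p l c = search-max K w p l c (chain-bound l w p c)

      longest-chain : ∀ w p → 0 < longest w p → Σ ℕ λ l → longest w p ≡ suc l × Chain (suc l) w p
      longest-chain w p pos with longest w p | search-chain K w p
      ... | suc l | inj₂ c = l , refl , c

      longest-oriented : ∀ w → OrientedEdge w → 1 ≤ longest w false
      longest-oriented w oriented = longest-max w false 1 (single-chain w oriented)

      -- Chains ending with an even index have odd length; the others even length.
      chain-parity : ∀ l w p → Chain (suc l) w p → odd l ≡ p
      chain-parity l w p (_ , _ , _ , parity) = parity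

      cap-odd cap-even : ℕ
      cap-odd = if odd K then suc K else K
      cap-even = if odd K then K ∸ 1 else K

      caps : cap-odd + cap-even ≡ K + K
      caps with odd K in parity
      ... | true = trans (sym (+-suc K (K ∸ 1))) (cong (K +_) (m+[n∸m]≡n (odd⇒positive K parity)))
      ... | false = refl

      odd-length-cap : ∀ a → odd a ≡ true → a ≤ K → a + 1 ≤ cap-odd
      odd-length-cap a a-odd a≤K with odd K in parity
      ... | true = subst (_≤ suc K) (+-comm 1 a) (s≤s a≤K)
      ... | false = subst (_≤ K) (+-comm 1 a) (≤∧≢⇒< a≤K (λ { refl → true≢false (trans (sym a-odd) parity) }))
        where
        true≢false : true ≢ false
        true≢false ()

      even-length-cap : ∀ a → (a ≡ 0 ⊎ odd a ≡ false) → a ≤ K → a ≤ cap-even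
      even-length-cap a even a≤K with odd K in parity
      ... | false = a≤K
      ... | true with even
      ...   | inj₁ refl = z≤n
      ...   | inj₂ a-even = subst (a ≤_) (pred[m∸n]≡m∸[1+n] K 0) (<⇒≤pred (≤∧≢⇒< a≤K (λ { refl → false≢true (trans (sym a-even) parity) })))
        where
        false≢true : false ≢ true
        false≢true ()

      -- The candidates are the x with x ∷ g an oriented edge;
      -- a chain ending in x ∷ g extends by any candidate y placed correctly,
      -- which is decided by the clockwise order of x, y seen from last g.
      module AtPrefix (g : Vec (Fin n) m) where
        Candidate : Fin n → Set
        Candidate x = OrientedEdge (x ∷ g)

        candidate? : ∀ x → Dec (Candidate x)
        candidate? x = oriented? n m' H (x ∷ g)

        key : Fin n → ℕ
        key x = rot (last g) x

        key-injective : ∀ x y → Candidate x → Candidate y → key x ≡ key y → x ≡ y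
        key-injective x y _ _ = rot-inj (last g) x y

        completes : ∀ y → Candidate y → OrientedEdge (g ∷ʳ y)
        completes y = oriented-rotate n m' H (y ∷ g)

        -- Chains ending at an even index (odd length) and at an odd index.
        aE bE aO bO : Fin n → ℕ
        aE x = longest (x ∷ g) false
        bE x = longest (g ∷ʳ x) true
        aO x = longest (x ∷ g) true
        bO x = longest (g ∷ʳ x) false

        extend-even : ∀ x y → Candidate x → Candidate y → key x < key y → aE x < bE y
        extend-even x y cx cy lt with longest-chain (x ∷ g) false (longest-oriented (x ∷ g) cx)
        ... | l , eq , c = subst (_< bE y) (sym eq)
          (longest-max (g ∷ʳ y) true (suc (suc l)) (extend l x g y false c (completes y cy) (between-first-and-head x y g (proj₁ cx) (proj₁ cy) lt)))

        extend-odd : ∀ x y → Candidate x → Candidate y → n ∸ key x < n ∸ key y → aO x < bO y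
        extend-odd x y cx cy lt with aO x in eq
        ... | zero = longest-oriented (g ∷ʳ y) (completes y cy)
        ... | suc _ with longest-chain (x ∷ g) true (subst (0 <_) (sym eq) (s≤s z≤n))
        ...   | l , eq′ , c = subst (_< bO y) (trans (sym eq′) eq)
          (longest-max (g ∷ʳ y) false (suc (suc l)) (extend l x g y true c (completes y cy) (between-last-and-first x y g (proj₁ cy) y<x)))
          where
          y<x : key y < key x
          y<x = ≰⇒> (λ x≤y → <⇒≱ lt (∸-monoʳ-≤ n x≤y))

        Σ-candidates : (Fin n → ℕ) → ℕ
        Σ-candidates F = sum (λ x → 𝟙 (candidate? x) * F x)

        telescope-even : Σ-candidates (λ x → 1 + aE x) ≤ cap-odd + Σ-candidates bE
        telescope-even = telescope Candidate candidate? aE bE key 0 (λ _ _ → z≤n) extend-even key-injective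
                           n cap-odd (λ x → rot<n (last g) x) last≤
          where
          last≤ : ∀ x → Candidate x → aE x + 1 ≤ cap-odd + 0
          last≤ x cx with longest-chain (x ∷ g) false (longest-oriented (x ∷ g) cx)
          ... | l , eq , c = subst₂ _≤_ (cong (_+ 1) (sym eq)) (sym (+-identityʳ cap-odd))
            (odd-length-cap (suc l) (cong not (chain-parity l (x ∷ g) false c)) (subst (_≤ K) eq (search≤ K (x ∷ g) false)))

        telescope-odd : Σ-candidates (λ x → 1 + aO x) ≤ cap-even + Σ-candidates bO
        telescope-odd = telescope Candidate candidate? aO bO (λ x → n ∸ key x) 1 (λ x cx → longest-oriented (g ∷ʳ x) (completes x cx))
                          extend-odd key-injective′ (suc n) cap-even (λ x → s≤s (m∸n≤m n (key x))) last≤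
          where
          key-injective′ : ∀ x y → Candidate x → Candidate y → n ∸ key x ≡ n ∸ key y → x ≡ y
          key-injective′ x y cx cy e = key-injective x y cx cy
            (trans (sym (m∸[m∸n]≡n (<⇒≤ (rot<n (last g) x)))) (trans (cong (n ∸_) e) (m∸[m∸n]≡n (<⇒≤ (rot<n (last g) y)))))
          even-length : ∀ x → aO x ≡ 0 ⊎ odd (aO x) ≡ false
          even-length x with search-chain K (x ∷ g) true
          ... | inj₁ none = inj₁ none
          ... | inj₂ c with aO x
          ...   | suc l = inj₂ (cong not (chain-parity l (x ∷ g) true c))
          last≤ : ∀ x → Candidate x → aO x + 1 ≤ cap-even + 1
          last≤ x _ = +-monoˡ-≤ 1 (even-length-cap (aO x) (even-length x) (search≤ K (x ∷ g) true))

      -- For a fixed prefix g, the two telescoping inequalities together (the left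
      -- side vanishes unless g is clockwise).
      per-prefix : ∀ g → AtPrefix.Σ-candidates g (λ x → 1 + AtPrefix.aE g x) + AtPrefix.Σ-candidates g (λ x → 1 + AtPrefix.aO g x)
                         ≤ (K + K) * 𝟙 (clockwise? g) + (AtPrefix.Σ-candidates g (AtPrefix.bE g) + AtPrefix.Σ-candidates g (AtPrefix.bO g))
      per-prefix g with clockwise? g
      ... | yes _ = begin
        Σ-candidates (λ x → 1 + aE x) + Σ-candidates (λ x → 1 + aO x)  ≤⟨ +-mono-≤ telescope-even telescope-odd ⟩
        (cap-odd + Σ-candidates bE) + (cap-even + Σ-candidates bO)      ≡⟨ interchange cap-odd _ cap-even _ ⟩
        (cap-odd + cap-even) + (Σ-candidates bE + Σ-candidates bO)      ≡⟨ cong₂ _+_ (trans caps (sym (*-identityʳ (K + K)))) refl ⟩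
        (K + K) * 1 + (Σ-candidates bE + Σ-candidates bO)               ∎
        where
        open AtPrefix g
        open ≤-Reasoning
      ... | no ¬clockwise = ≤-trans (≤-reflexive (cong₂ _+_ (sum-zero (no-candidates (λ x → 1 + aE x))) (sum-zero (no-candidates (λ x → 1 + aO x))))) z≤n
        where
        open AtPrefix g
        no-candidates : ∀ (F : Fin n → ℕ) x → 𝟙 (candidate? x) * F x ≡ 0
        no-candidates F x = cong (_* F x) (𝟙-no (candidate? x) (λ cx → ¬clockwise (clockwise-tail x g (proj₁ cx))))

      N : ℕ
      N = Σ-tuples r (λ w → 𝟙 (oriented? n m' H w))

      A : Bool → ℕ
      A p = Σ-tuples r (λ w → 𝟙 (oriented? n m' H w) * longest w p)

      CS : ℕ
      CS = Σ-tuples m (λ g → 𝟙 (clockwise? g))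

      N+A : ∀ p → Σ-tuples r (λ w → 𝟙 (oriented? n m' H w) * (1 + longest w p)) ≡ N + A p
      N+A p = trans (Σ-tuples-cong r (λ w → trans (*-distribˡ-+ (𝟙 (oriented? n m' H w)) 1 (longest w p))
                                                  (cong (_+ 𝟙 (oriented? n m' H w) * longest w p) (*-identityʳ (𝟙 (oriented? n m' H w))))))
                    (Σ-tuples-+ r (λ w → 𝟙 (oriented? n m' H w)) (λ w → 𝟙 (oriented? n m' H w) * longest w p))

      -- Since rotation permutes oriented edges, summing over the rotated edges gives A p again.
      A-rotated : ∀ p → Σ-tuples r (λ w → 𝟙 (oriented? n m' H w) * longest (rotate w) p) ≡ A p
      A-rotated p = trans (Σ-tuples-cong r (λ w → cong (_* longest (rotate w) p)
                            (𝟙-cong (oriented? n m' H w) (oriented? n m' H (rotate w)) (oriented-rotate n m' H w) (oriented-unrotate n m' H w))))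
                          (Σ-tuples-rotate m (λ w → 𝟙 (oriented? n m' H w) * longest w p))

      -- Summing `per-prefix` over all prefixes; the right hand side refers to the
      -- rotated edges g ∷ʳ x, hence to A again.
      double-count : (N + A false) + (N + A true) ≤ (K + K) * CS + (A true + A false)
      double-count = begin
        (N + A false) + (N + A true)
          ≡⟨ cong₂ _+_ (N+A false) (N+A true) ⟨
        Σ-tuples r (λ w → 𝟙 (oriented? n m' H w) * (1 + longest w false)) + Σ-tuples r (λ w → 𝟙 (oriented? n m' H w) * (1 + longest w true))
          ≡⟨ Σ-tuples-+ m (λ g → AtPrefix.Σ-candidates g (λ x → 1 + AtPrefix.aE g x)) (λ g → AtPrefix.Σ-candidates g (λ x → 1 + AtPrefix.aO g x)) ⟨
        Σ-tuples m (λ g → LHS g)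
          ≤⟨ Σ-tuples-mono m per-prefix ⟩
        Σ-tuples m (λ g → (K + K) * 𝟙 (clockwise? g) + RHS g)
          ≡⟨ Σ-tuples-+ m (λ g → (K + K) * 𝟙 (clockwise? g)) RHS ⟩
        Σ-tuples m (λ g → (K + K) * 𝟙 (clockwise? g)) + Σ-tuples m RHS
          ≡⟨ cong₂ _+_ (Σ-tuples-* m (K + K) (λ g → 𝟙 (clockwise? g)))
                       (Σ-tuples-+ m (λ g → AtPrefix.Σ-candidates g (AtPrefix.bE g)) (λ g → AtPrefix.Σ-candidates g (AtPrefix.bO g))) ⟩
        (K + K) * CS + (Σ-tuples r (λ w → 𝟙 (oriented? n m' H w) * longest (rotate w) true) +
                        Σ-tuples r (λ w → 𝟙 (oriented? n m' H w) * longest (rotate w) false))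
          ≡⟨ cong ((K + K) * CS +_) (cong₂ _+_ (A-rotated true) (A-rotated false)) ⟩
        (K + K) * CS + (A true + A false) ∎
        where
        open ≤-Reasoning
        LHS RHS : Vec (Fin n) m → ℕ
        LHS g = AtPrefix.Σ-candidates g (λ x → 1 + AtPrefix.aE g x) + AtPrefix.Σ-candidates g (λ x → 1 + AtPrefix.aO g x)
        RHS g = AtPrefix.Σ-candidates g (AtPrefix.bE g) + AtPrefix.Σ-candidates g (AtPrefix.bO g)

      N≤K*CS : N ≤ K * CS
      N≤K*CS = *-cancelˡ-≤ 2 (begin
        2 * N                                  ≡⟨ cong (N +_) (+-identityʳ N) ⟩
        N + N                                  ≤⟨ +-cancelʳ-≤ (A false + A true) _ _ (subst₂ _≤_ (interchange N (A false) N (A true))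
                                                    (cong ((K + K) * CS +_) (+-comm (A true) (A false))) double-count) ⟩
        (K + K) * CS                           ≡⟨ *-distribʳ-+ CS K K ⟩
        K * CS + K * CS                        ≡⟨ cong (K * CS +_) (+-identityʳ (K * CS)) ⟨
        2 * (K * CS)                           ∎)
        where open ≤-Reasoning

      edges-bound : r * length (edges H) ≤ K * m * (n C m)
      edges-bound = begin
        r * length (edges H)    ≤⟨ edges≤oriented n m' H ⟩
        N                       ≤⟨ N≤K*CS ⟩
        K * CS                  ≤⟨ *-monoʳ-≤ K (CountClockwise.clockwise≤ n' m') ⟩
        K * (m * (n C m))       ≡⟨ *-assoc K m (n C m) ⟨
        K * m * (n C m)         ∎
        where open ≤-Reasoning

module FiniteDoubleNegation where
  open import Data.Nat using (ℕ; zero; suc; _<_; _≟_; s≤s⁻¹)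
  open import Data.Nat.Properties using (<-trans; n<1+n; ≤∧≢⇒<)
  open import Data.Fin using (Fin; zero; suc)
  open import Data.Vec using (Vec; []; _∷_)
  open import Data.Bool using (Bool; true; false)
  open import Relation.Binary.PropositionalEquality using (refl)
  open import Relation.Nullary using (yes; no)
  open import Relation.Nullary.Negation using (DoubleNegation)

  -- Double negation commutes with quantification over finite domains.  This
  -- lets us assume excluded middle for finitely many propositions while
  -- proving a ¬¬-stable statement.
  ¬¬-Π-Fin : ∀ N {X : Fin N → Set} → (∀ i → DoubleNegation (X i)) → DoubleNegation (∀ i → X i)
  ¬¬-Π-Fin zero _ k = k (λ ())
  ¬¬-Π-Fin (suc N) {X} h k =
    h zero λ x₀ → ¬¬-Π-Fin N {λ i → X (suc i)} (λ i → h (suc i)) λ rest → k λ { zero → x₀ ; (suc i) → rest i }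

  ¬¬-Π-tuples : ∀ n j {X : Vec (Fin n) j → Set} → (∀ w → DoubleNegation (X w)) → DoubleNegation (∀ w → X w)
  ¬¬-Π-tuples n zero h k = h [] λ x → k λ { [] → x }
  ¬¬-Π-tuples n (suc j) {X} h k =
    ¬¬-Π-Fin n {λ x → ∀ g → X (x ∷ g)} (λ x → ¬¬-Π-tuples n j (λ g → h (x ∷ g))) λ f → k λ { (x ∷ g) → f x g }

  ¬¬-Π-Bool : ∀ {X : Bool → Set} → (∀ b → DoubleNegation (X b)) → DoubleNegation (∀ b → X b)
  ¬¬-Π-Bool h k = h true λ x-true → h false λ x-false → k λ { true → x-true ; false → x-false }

  ¬¬-Π-below : ∀ T {X : ℕ → Set} → (∀ l → l < T → DoubleNegation (X l)) → DoubleNegation (∀ l → l < T → X l)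
  ¬¬-Π-below zero _ k = k (λ l ())
  ¬¬-Π-below (suc T) {X} h k =
    ¬¬-Π-below T (λ l l<T → h l (<-trans l<T (n<1+n T))) λ below → h T (n<1+n T) λ x-T → k (extend below x-T)
    where
    extend : (∀ l → l < T → X l) → X T → ∀ l → l < suc T → X l
    extend below x-T l l<T+1 with l ≟ T
    ... | yes refl = x-T
    ... | no l≢T = below l (≤∧≢⇒< (s≤s⁻¹ l<T+1) l≢T)

open Counting using (module Longest)
open FiniteDoubleNegation

-- The bound holds once chains of length at most K are decidable; this is
-- true classically, and the bound, an inequality of numbers, is ¬¬-stable.
theorem1p5 : (n k r : ℕ) → 1 ≤ n → 1 ≤ k → 2 ≤ r → 2 ∣ r →
    (H : CGH n r) → ¬ Zigzag n r k H →
    r * length (edges H) ≤ (k ∸ 1) * (r ∸ 1) * (n C (r ∸ 1))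
theorem1p5 (suc n') (suc K) (suc (suc m')) _ _ _ 2∣r H no-zigzag =
  decidable-stable (_ ≤? _) (¬¬-map (Longest.edges-bound n' m' K H 2∣r no-zigzag) chains-decidable)
  where
  open LocalZigzags.Local (suc n') m' H using (Chain)
  chains-decidable : DoubleNegation (∀ l → l < suc K → ∀ w p → Dec (Chain l w p))
  chains-decidable = ¬¬-Π-below (suc K) (λ l _ → ¬¬-Π-tuples _ _ (λ w → ¬¬-Π-Bool (λ p → ¬¬-excluded-middle)))
theorem1p5 zero _ _ () _ _ _ _ _
theorem1p5 (suc n') zero _ _ () _ _ _ _
theorem1p5 (suc n') (suc K) zero _ _ () _ _ _
theorem1p5 (suc n') (suc K) (suc zero) _ _ (s≤s ()) _ _ _
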